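{- Let $S\neq\emptyset$ be admissible, let $m=\max S$, $S_1=S\setminus\{m\}$ and $S_2=S_1\cup\{m-1\}$. Then, as polynomials in $n$, \[p_B(S,n)=p_B(S_1,m-1)\binom{n}{m-1}-2p_B(S_1,n)-p_B(S_2,n).\]
   Context: $B_n$ is the set of signed permutations $\pi=\pi_1\cdots\pi_n$: words with each $\pi_i\in\{ -n,\dots,-1,1,\dots,n\}$ and $\{|\pi_1|,\dots,|\pi_n|\}=\{1,\dots,n\}$. An index $i\in\{2,\dots,n-1\}$ is a peak of $\pi$ if $\pi_{i-1}<\pi_i>\pi_{i+1}$; $P_B(S,n)$ is the set of $\pi\in B_n$ with peak set exactly $S$. $S$ is $n$-admissible if $\#P_B(S,n)\ne0$, admissible if $n$-admissible for some $n$. For an admissible set $T$ with $|T|=t$, $p_B(T,n)$ denotes the (integer-valued) polynomial in $n$ such that $\#P_B(T,n)=p_B(T,n)2^{2n-t-1}$ for all $n$ for which $T$ is $n$-admissible; for a set $T$ that is never admissible (e.g. containing two consecutive integers or the element $1$), $p_B(T,n)=0$. -}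

module Defs where

open import Data.Bool using (Bool; true; false; _∧_; if_then_else_)
open import Data.Nat as ℕ using (ℕ; zero; suc; _+_; _*_; _∸_; _^_)
open import Data.Nat.Properties using (m^n≢0)
open import Data.Integer as ℤ using (ℤ; +_; -_; ∣_∣)
open import Data.List using (List; []; _∷_; map; length; filterᵇ; concatMap; upTo; _++_)
open import Data.Bool.ListAction using (all; any)
open import Data.List.Properties using (≡-dec)
open import Data.List.Relation.Unary.Linked using (Linked)
open import Data.Product using (∃)
open import Data.Rational as ℚ using (ℚ)
open import Relation.Nullary.Decidable using (⌊_⌋)
open import Relation.Binary.PropositionalEquality using (_≢_)

oneTo : ℕ → List ℕ
oneTo n = map suc (upTo n)

alphabet : ℕ → List ℤ
alphabet n = map (λ k → - (+ k)) (oneTo n) ++ map +_ (oneTo n)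

words : ℕ → List ℤ → List (List ℤ)
words zero    A = [] ∷ []
words (suc k) A = concatMap (λ a → map (a ∷_) (words k A)) A

-- {|w_1|,...,|w_n|} ⊇ {1,...,n}  (with length n and letters from the
-- alphabet this is exactly {|w_i|} = {1..n})
absCovers : ℕ → List ℤ → Bool
absCovers n w = all (λ k → any (λ x → ⌊ ∣ x ∣ ℕ.≟ k ⌋) w) (oneTo n)

B : ℕ → List (List ℤ)
B n = filterᵇ (absCovers n) (words n (alphabet n))

-- peak set of a word, as a strictly increasing list of (1-based) indices i
-- with π_{i-1} < π_i > π_{i+1}; the first argument is the index of the head
peaksFrom : ℕ → List ℤ → List ℕ
peaksFrom i (a ∷ rest@(b ∷ c ∷ _)) =
  if ⌊ a ℤ.<? b ⌋ ∧ ⌊ c ℤ.<? b ⌋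
  then suc i ∷ peaksFrom (suc i) rest
  else peaksFrom (suc i) rest
peaksFrom i _ = []

peakSet : List ℤ → List ℕ
peakSet = peaksFrom 1

-- finite sets of positive integers are represented by strictly increasing lists
StrictlyIncreasing : List ℕ → Set
StrictlyIncreasing = Linked ℕ._<_

countPB : List ℕ → ℕ → ℕ
countPB S n = length (filterᵇ (λ π → ⌊ ≡-dec ℕ._≟_ (peakSet π) S ⌋) (B n))

NAdmissible : List ℕ → ℕ → Set
NAdmissible S n = countPB S n ≢ 0

Admissible : List ℕ → Set
Admissible S = ∃ λ n → NAdmissible S n

-- p_B(T,n) = #P_B(T,n) / 2^(2n-t-1), t = |T|.  For n with T n-admissible this
-- is the value of the polynomial p_B(T,-) at n; for T never admissible it is 0.
pB : List ℕ → ℕ → ℚ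
pB T n = (+ countPB T n) ℚ./ (2 ^ k) where
  k = 2 * n ∸ length T ∸ 1
  instance _ = m^n≢0 2 k

insert : ℕ → List ℕ → List ℕ
insert x [] = x ∷ []
insert x (y ∷ ys) with ℕ.compare x y
... | ℕ.less _ _    = x ∷ y ∷ ys
... | ℕ.equal _     = y ∷ ys
... | ℕ.greater _ _ = y ∷ insert x ys

{-# OPTIONS --safe #-}
-- Cut a signed permutation π ∈ B_n into a prefix u of length j = m - 1 and a suffix v of
-- length k = n - j. Two peaks are never adjacent, so the peaks of π are those of u, those of v
-- shifted by j, and at most one junction peak, at j or at m. As max S₁ < j, π has one of the
-- peak sets S, S₁, S₂ exactly when u has peak set S₁ and v has no peak. Choosing the j absolute
-- values used by u and relabelling both parts order-preservingly gives
--   #P_B(S,n) + #P_B(S₁,n) + #P_B(S₂,n) = C(n, j) · #P_B(S₁, j) · #P_B(∅, k).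
-- Moreover #P_B(∅,k) = 2^(2k-1): a peak-free signed permutation has exactly two cuts into a
-- descending prefix and an ascending suffix, and the signed permutations of length k cut after
-- p letters into a descending and an ascending part number C(k,p) · 2^p · 2^(k-p); summing over p
-- gives 2 · #P_B(∅,k) = 4^k. Dividing by 2^(2n-|S|-1) turns the count identity into the one for p_B.

module Submission where

module PeakCounting where

  open import Data.Bool using (Bool; true; false; _∧_; _∨_; not; if_then_else_)
  open import Data.Bool.Properties using (∧-identityʳ; ∧-zeroʳ; ∧-comm; ∨-identityʳ; ∨-comm; ∨-assoc; ¬-not; ∧-conicalˡ; ∧-conicalʳ; not-injective; ⇔→≡)
  open import Data.Bool.ListAction using (all; any)
  open import Data.Empty using (⊥-elim)
  open import Data.Integer as ℤ using (ℤ; -[1+_]; -_; ∣_∣)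
  import Data.Integer.Properties as ℤ
  import Data.Integer.Tactic.RingSolver as ℤ-Ring
  open import Data.List using (List; []; _∷_; _∷ʳ_; _++_; map; length; filterᵇ; concatMap; take; drop; applyUpTo)
  open import Data.List.Properties using (map-++; map-∘; map-cong; length-map; length-++; ∷-injective; ∷-injectiveˡ; ++-conicalʳ; ++-identityʳ; ≡-dec)
  open import Data.List.Relation.Unary.All as All using (All; []; _∷_)
  open import Data.List.Relation.Unary.All.Properties as All using ()
  open import Data.List.Relation.Unary.Linked using (Linked; []; [-]; _∷_)
  open import Data.Nat as ℕ using (ℕ; zero; suc; _+_; _*_; _∸_; _^_; _≤_; _<_; z≤n; s≤s; s<s)
  open import Data.Nat.Combinatorics using (_C_; nCn≡1; nC1≡n; nCk+nC[k+1]≡[n+1]C[k+1])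
  open import Data.Nat.Properties
  open import Data.Nat.Tactic.RingSolver using (solve-∀)
  import Data.Rational as ℚ
  open import Data.Rational.Properties using (toℚᵘ-injective; toℚᵘ-fromℚᵘ; toℚᵘ-homo-+; toℚᵘ-homo-*; toℚᵘ-homo‿-; /-cong)
  import Data.Rational.Unnormalised as ℚᵘ
  import Data.Rational.Unnormalised.Properties as ℚᵘ
  open import Data.Product using (_×_; _,_; proj₁; proj₂; ∃)
  open import Data.Unit using (tt)
  open import Function using (_∘_; id; _⇔_; mk⇔; Equivalence)
  open import Relation.Binary.PropositionalEquality using (_≡_; _≢_; refl; sym; trans; cong; cong₂; subst; subst₂; module ≡-Reasoning)
  open import Relation.Binary.Core using (_Preserves_⟶_)
  open import Relation.Binary.Definitions using (tri<; tri≈; tri>)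
  open import Relation.Nullary using (¬_; Dec; yes; no)
  open import Relation.Nullary.Decidable using (⌊_⌋; isYes≗does; dec-true; dec-false; does-⇔)
  open import Defs

  private
    variable
      A A′ : Set

  ⌊⌋-true : {P : Set} (p? : Dec P) → P → ⌊ p? ⌋ ≡ true
  ⌊⌋-true p? p = trans (isYes≗does p?) (dec-true p? p)

  ⌊⌋-false : {P : Set} (p? : Dec P) → ¬ P → ⌊ p? ⌋ ≡ false
  ⌊⌋-false p? ¬p = trans (isYes≗does p?) (dec-false p? ¬p)

  ⌊⌋≡true⇒ : {P : Set} (p? : Dec P) → ⌊ p? ⌋ ≡ true → P
  ⌊⌋≡true⇒ (yes p) _ = p

  ⌊⌋-⇔ : {P Q : Set} → P ⇔ Q → (p? : Dec P) (q? : Dec Q) → ⌊ p? ⌋ ≡ ⌊ q? ⌋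
  ⌊⌋-⇔ P⇔Q p? q? = trans (isYes≗does p?) (trans (does-⇔ P⇔Q p? q?) (sym (isYes≗does q?)))

  filterᵇ-++ : (p : A → Bool) (xs ys : List A) → filterᵇ p (xs ++ ys) ≡ filterᵇ p xs ++ filterᵇ p ys
  filterᵇ-++ p []       ys = refl
  filterᵇ-++ p (x ∷ xs) ys with p x
  ... | true  = cong (x ∷_) (filterᵇ-++ p xs ys)
  ... | false = filterᵇ-++ p xs ys

  filterᵇ-map : (p : A′ → Bool) (f : A → A′) (xs : List A) → filterᵇ p (map f xs) ≡ map f (filterᵇ (p ∘ f) xs)
  filterᵇ-map p f []       = refl
  filterᵇ-map p f (x ∷ xs) with p (f x)
  ... | true  = cong (f x ∷_) (filterᵇ-map p f xs)
  ... | false = filterᵇ-map p f xs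

  filterᵇ-cong : {p q : A → Bool} → (∀ x → p x ≡ q x) → (xs : List A) → filterᵇ p xs ≡ filterᵇ q xs
  filterᵇ-cong p≗q [] = refl
  filterᵇ-cong {p = p} {q} p≗q (x ∷ xs) with p x | q x | p≗q x
  ... | true  | true  | _ = cong (x ∷_) (filterᵇ-cong p≗q xs)
  ... | false | false | _ = filterᵇ-cong p≗q xs

  filterᵇ-witness : (p : A → Bool) (xs : List A) → length (filterᵇ p xs) ≢ 0 → ∃ λ x → p x ≡ true
  filterᵇ-witness p []       nonempty = ⊥-elim (nonempty refl)
  filterᵇ-witness p (x ∷ xs) nonempty with p x in px
  ... | true  = x , px
  ... | false = filterᵇ-witness p xs nonempty

  any-++ : (p : A → Bool) (u v : List A) → any p (u ++ v) ≡ any p u ∨ any p v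
  any-++ p []      v = refl
  any-++ p (x ∷ u) v = trans (cong (p x ∨_) (any-++ p u v)) (sym (∨-assoc (p x) _ _))

  take-length-++ : (u v : List A) → take (length u) (u ++ v) ≡ u
  take-length-++ []      v = refl
  take-length-++ (x ∷ u) v = cong (x ∷_) (take-length-++ u v)

  drop-length-++ : (u v : List A) → drop (length u) (u ++ v) ≡ v
  drop-length-++ []      v = refl
  drop-length-++ (x ∷ u) v = drop-length-++ u v

  length-∷ʳ : ∀ (xs : List A) x → length (xs ∷ʳ x) ≡ suc (length xs)
  length-∷ʳ xs x = trans (length-++ xs) (+-comm (length xs) 1)

  if-∷-++ : ∀ (b : Bool) (p : A) xs ys → (if b then p ∷ xs else xs) ++ ys ≡ (if b then p ∷ (xs ++ ys) else xs ++ ys)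
  if-∷-++ true  p xs ys = refl
  if-∷-++ false p xs ys = refl

  All-if : ∀ (b : Bool) {P : A → Set} p xs → P p → All P xs → All P (if b then p ∷ xs else xs)
  All-if true  p xs pp pxs = pp ∷ pxs
  All-if false p xs pp pxs = pxs

  Linked-++⁻ˡ : ∀ {R : A → A → Set} xs ys → Linked R (xs ++ ys) → Linked R xs
  Linked-++⁻ˡ []           ys _            = []
  Linked-++⁻ˡ (x ∷ [])     ys _            = [-]
  Linked-++⁻ˡ (x ∷ y ∷ xs) ys (xRy ∷ linked) = xRy ∷ Linked-++⁻ˡ (y ∷ xs) ys linked

  𝟙 : Bool → ℕ
  𝟙 true  = 1
  𝟙 false = 0

  𝟙-∧ : ∀ a b → 𝟙 (a ∧ b) ≡ 𝟙 a * 𝟙 b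
  𝟙-∧ true  b = sym (+-identityʳ (𝟙 b))
  𝟙-∧ false b = refl

  𝟙-∧-+-+ : ∀ a b c d → 𝟙 (a ∧ b) + 𝟙 (a ∧ c) + 𝟙 (a ∧ d) ≡ 𝟙 a * (𝟙 b + 𝟙 c + 𝟙 d)
  𝟙-∧-+-+ true  b c d = sym (+-identityʳ _)
  𝟙-∧-+-+ false b c d = refl

  𝟙-∨-redundant : ∀ b h x → 𝟙 h * x ≡ 0 → 𝟙 (b ∨ h) * x ≡ 𝟙 b * x
  𝟙-∨-redundant true  h x _      = refl
  𝟙-∨-redundant false h x h*x≡0 = h*x≡0

  𝟙-exclusive : ∀ h d e → (h ≡ true → e ≡ false) → 𝟙 h * 𝟙 (d ∧ e) ≡ 0
  𝟙-exclusive false d e _     = refl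
  𝟙-exclusive true  d e h⇒¬e rewrite h⇒¬e refl | ∧-zeroʳ d = refl

  𝟙-guard : ∀ a d e e′ → (a ≡ true → e ≡ e′) → 𝟙 ((a ∧ d) ∧ e) ≡ 𝟙 a * 𝟙 (d ∧ e′)
  𝟙-guard false d e e′ _    = refl
  𝟙-guard true  d e e′ e≡e′ = trans (cong (λ e → 𝟙 (d ∧ e)) (e≡e′ refl)) (sym (+-identityʳ _))

  ∑ : List A → (A → ℕ) → ℕ
  ∑ []       f = 0
  ∑ (x ∷ xs) f = f x + ∑ xs f

  length-filterᵇ : (p : A → Bool) (xs : List A) → length (filterᵇ p xs) ≡ ∑ xs (𝟙 ∘ p)
  length-filterᵇ p [] = refl
  length-filterᵇ p (x ∷ xs) with p x
  ... | true  = cong suc (length-filterᵇ p xs)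
  ... | false = length-filterᵇ p xs

  ∑-filterᵇ : (p : A → Bool) (xs : List A) (f : A → ℕ) → ∑ (filterᵇ p xs) f ≡ ∑ xs (λ x → 𝟙 (p x) * f x)
  ∑-filterᵇ p [] f = refl
  ∑-filterᵇ p (x ∷ xs) f with p x
  ... | true  = cong₂ _+_ (sym (+-identityʳ (f x))) (∑-filterᵇ p xs f)
  ... | false = ∑-filterᵇ p xs f

  ∑-++ : (xs ys : List A) (f : A → ℕ) → ∑ (xs ++ ys) f ≡ ∑ xs f + ∑ ys f
  ∑-++ []       ys f = refl
  ∑-++ (x ∷ xs) ys f = trans (cong (f x +_) (∑-++ xs ys f)) (sym (+-assoc (f x) _ _))

  ∑-map : (g : A → A′) (xs : List A) (f : A′ → ℕ) → ∑ (map g xs) f ≡ ∑ xs (f ∘ g)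
  ∑-map g []       f = refl
  ∑-map g (x ∷ xs) f = cong (f (g x) +_) (∑-map g xs f)

  ∑-concatMap : (g : A → List A′) (xs : List A) (f : A′ → ℕ) → ∑ (concatMap g xs) f ≡ ∑ xs (λ x → ∑ (g x) f)
  ∑-concatMap g []       f = refl
  ∑-concatMap g (x ∷ xs) f = trans (∑-++ (g x) (concatMap g xs) f) (cong (∑ (g x) f +_) (∑-concatMap g xs f))

  ∑-cong : (xs : List A) {f g : A → ℕ} → (∀ x → f x ≡ g x) → ∑ xs f ≡ ∑ xs g
  ∑-cong []       f≗g = refl
  ∑-cong (x ∷ xs) f≗g = cong₂ _+_ (f≗g x) (∑-cong xs f≗g)

  ∑-cong-All : {P : A → Set} {xs : List A} → All P xs → {f g : A → ℕ} → (∀ x → P x → f x ≡ g x) → ∑ xs f ≡ ∑ xs g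
  ∑-cong-All []         f≗g = refl
  ∑-cong-All (px ∷ pxs) f≗g = cong₂ _+_ (f≗g _ px) (∑-cong-All pxs f≗g)

  ∑-zero : (xs : List A) {f : A → ℕ} → (∀ x → f x ≡ 0) → ∑ xs f ≡ 0
  ∑-zero []       f≗0 = refl
  ∑-zero (x ∷ xs) f≗0 = cong₂ _+_ (f≗0 x) (∑-zero xs f≗0)

  ∑-+ : (xs : List A) (f g : A → ℕ) → ∑ xs (λ x → f x + g x) ≡ ∑ xs f + ∑ xs g
  ∑-+ []       f g = refl
  ∑-+ (x ∷ xs) f g = trans (cong (f x + g x +_) (∑-+ xs f g)) (+-+-swap (f x) (g x) (∑ xs f) (∑ xs g))
    where
    +-+-swap : ∀ a b c d → a + b + (c + d) ≡ a + c + (b + d)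
    +-+-swap = solve-∀

  ∑-*ˡ : (xs : List A) (c : ℕ) (f : A → ℕ) → ∑ xs (λ x → c * f x) ≡ c * ∑ xs f
  ∑-*ˡ []       c f = sym (*-zeroʳ c)
  ∑-*ˡ (x ∷ xs) c f = trans (cong (c * f x +_) (∑-*ˡ xs c f)) (sym (*-distribˡ-+ c (f x) _))

  ∑-*ʳ : (xs : List A) (c : ℕ) (f : A → ℕ) → ∑ xs (λ x → f x * c) ≡ ∑ xs f * c
  ∑-*ʳ xs c f = trans (∑-cong xs (λ x → *-comm (f x) c)) (trans (∑-*ˡ xs c f) (*-comm c _))

  ∑-const : (xs : List A) (c : ℕ) → ∑ xs (λ _ → c) ≡ length xs * c
  ∑-const []       c = refl
  ∑-const (x ∷ xs) c = cong (c +_) (∑-const xs c)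

  ∑-comm : (xs : List A) (ys : List A′) (f : A → A′ → ℕ) →
    ∑ xs (λ x → ∑ ys (f x)) ≡ ∑ ys (λ y → ∑ xs (λ x → f x y))
  ∑-comm []       ys f = sym (∑-zero ys (λ _ → refl))
  ∑-comm (x ∷ xs) ys f = trans (cong (∑ ys (f x) +_) (∑-comm xs ys f)) (sym (∑-+ ys (f x) _))

  ∑-words-suc : (k : ℕ) (xs : List ℤ) (f : List ℤ → ℕ) →
    ∑ (words (suc k) xs) f ≡ ∑ xs (λ x → ∑ (words k xs) (λ w → f (x ∷ w)))
  ∑-words-suc k xs f = trans (∑-concatMap (λ x → map (x ∷_) (words k xs)) xs f)
    (∑-cong xs (λ x → ∑-map (x ∷_) (words k xs) f))

  ∑-words-+ : (j k : ℕ) (xs : List ℤ) (f : List ℤ → ℕ) →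
    ∑ (words (j + k) xs) f ≡ ∑ (words j xs) (λ u → ∑ (words k xs) (λ v → f (u ++ v)))
  ∑-words-+ zero    k xs f = sym (+-identityʳ _)
  ∑-words-+ (suc j) k xs f = trans (∑-words-suc (j + k) xs f)
    (trans (∑-cong xs (λ x → ∑-words-+ j k xs (λ w → f (x ∷ w))))
      (sym (∑-words-suc j xs _)))

  ∑-words-map : (k : ℕ) (g : ℤ → ℤ) (xs : List ℤ) (f : List ℤ → ℕ) →
    ∑ (words k (map g xs)) f ≡ ∑ (words k xs) (f ∘ map g)
  ∑-words-map zero    g xs f = refl
  ∑-words-map (suc k) g xs f = trans (∑-words-suc k (map g xs) f)
    (trans (∑-map g xs _)
      (trans (∑-cong xs (λ x → ∑-words-map k g xs (λ w → f (g x ∷ w))))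
        (sym (∑-words-suc k xs _))))

  ∑-words-filterᵇ : (k : ℕ) (p : ℤ → Bool) (xs : List ℤ) (f : List ℤ → ℕ) →
    ∑ (words k (filterᵇ p xs)) f ≡ ∑ (words k xs) (λ w → 𝟙 (all p w) * f w)
  ∑-words-filterᵇ zero    p xs f = sym (+-identityʳ _)
  ∑-words-filterᵇ (suc k) p xs f = begin
      ∑ (words (suc k) (filterᵇ p xs)) f
        ≡⟨ ∑-words-suc k (filterᵇ p xs) f ⟩
      ∑ (filterᵇ p xs) (λ x → ∑ (words k (filterᵇ p xs)) (λ w → f (x ∷ w)))
        ≡⟨ ∑-filterᵇ p xs _ ⟩
      ∑ xs (λ x → 𝟙 (p x) * ∑ (words k (filterᵇ p xs)) (λ w → f (x ∷ w)))
        ≡⟨ ∑-cong xs (λ x → cong (𝟙 (p x) *_) (∑-words-filterᵇ k p xs (λ w → f (x ∷ w)))) ⟩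
      ∑ xs (λ x → 𝟙 (p x) * ∑ (words k xs) (λ w → 𝟙 (all p w) * f (x ∷ w)))
        ≡⟨ ∑-cong xs (λ x → sym (∑-*ˡ (words k xs) (𝟙 (p x)) _)) ⟩
      ∑ xs (λ x → ∑ (words k xs) (λ w → 𝟙 (p x) * (𝟙 (all p w) * f (x ∷ w))))
        ≡⟨ ∑-cong xs (λ x → ∑-cong (words k xs) (λ w →
             trans (sym (*-assoc (𝟙 (p x)) _ _)) (cong (_* f (x ∷ w)) (sym (𝟙-∧ (p x) (all p w)))))) ⟩
      ∑ xs (λ x → ∑ (words k xs) (λ w → 𝟙 (all p (x ∷ w)) * f (x ∷ w)))
        ≡⟨ ∑-words-suc k xs _ ⟨
      ∑ (words (suc k) xs) (λ w → 𝟙 (all p w) * f w) ∎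
    where open ≡-Reasoning

  ∑-words-++-comm : (k : ℕ) (xs ys : List ℤ) (f : List ℤ → ℕ) →
    ∑ (words k (xs ++ ys)) f ≡ ∑ (words k (ys ++ xs)) f
  ∑-words-++-comm zero    xs ys f = refl
  ∑-words-++-comm (suc k) xs ys f = begin
      ∑ (words (suc k) (xs ++ ys)) f
        ≡⟨ ∑-words-suc k (xs ++ ys) f ⟩
      ∑ (xs ++ ys) (λ x → ∑ (words k (xs ++ ys)) (λ w → f (x ∷ w)))
        ≡⟨ ∑-cong (xs ++ ys) (λ x → ∑-words-++-comm k xs ys (λ w → f (x ∷ w))) ⟩
      ∑ (xs ++ ys) g
        ≡⟨ ∑-++ xs ys g ⟩
      ∑ xs g + ∑ ys g
        ≡⟨ +-comm (∑ xs g) (∑ ys g) ⟩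
      ∑ ys g + ∑ xs g
        ≡⟨ ∑-++ ys xs g ⟨
      ∑ (ys ++ xs) g
        ≡⟨ ∑-words-suc k (ys ++ xs) f ⟨
      ∑ (words (suc k) (ys ++ xs)) f ∎
    where
    open ≡-Reasoning
    g : ℤ → ℕ
    g x = ∑ (words k (ys ++ xs)) (λ w → f (x ∷ w))

  ∑-words-cong : {P : ℤ → Set} (k : ℕ) {xs : List ℤ} → All P xs → {f g : List ℤ → ℕ} →
    (∀ w → length w ≡ k → All P w → f w ≡ g w) → ∑ (words k xs) f ≡ ∑ (words k xs) g
  ∑-words-cong zero    pxs f≗g = cong (_+ 0) (f≗g [] refl [])
  ∑-words-cong (suc k) {xs} pxs {f} {g} f≗g = trans (∑-words-suc k xs f)
    (trans (∑-cong-All pxs (λ x px → ∑-words-cong k pxs (λ w lw pw → f≗g (x ∷ w) (cong suc lw) (px ∷ pw))))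
      (sym (∑-words-suc k xs g)))

  range : ℕ → ℕ → List ℕ
  range s zero    = []
  range s (suc l) = s ∷ range (suc s) l

  length-range : ∀ s l → length (range s l) ≡ l
  length-range s zero    = refl
  length-range s (suc l) = cong suc (length-range (suc s) l)

  range-suc : ∀ s l → range (suc s) l ≡ map suc (range s l)
  range-suc s zero    = refl
  range-suc s (suc l) = cong (suc s ∷_) (range-suc (suc s) l)

  ∑-range-suc : ∀ s l (f : ℕ → ℕ) → ∑ (range (suc s) l) f ≡ ∑ (range s l) (f ∘ suc)
  ∑-range-suc s l f = trans (cong (λ xs → ∑ xs f) (range-suc s l)) (∑-map suc (range s l) f)

  range-bounds : ∀ s l → All (λ a → s ≤ a × a < s + l) (range s l)
  range-bounds s zero    = []
  range-bounds s (suc l) = (≤-refl , s<s+suc) ∷ All.map (λ {a} (s<a , a<) → <⇒≤ s<a , subst (a <_) (sym (+-suc s l)) a<) (range-bounds (suc s) l)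
    where
    s<s+suc : s < s + suc l
    s<s+suc = subst (s <_) (sym (+-suc s l)) (s<s (m≤m+n s l))

  ∑-range-indicator-absent : ∀ b s l (f : ℕ → ℕ) → b < s → ∑ (range s l) (λ a → 𝟙 ⌊ b ℕ.≟ a ⌋ * f a) ≡ 0
  ∑-range-indicator-absent b s l f b<s = trans
    (∑-cong-All (range-bounds s l) (λ a (s≤a , _) → cong (λ e → 𝟙 e * f a) (⌊⌋-false (b ℕ.≟ a) (λ { refl → <⇒≱ b<s s≤a }))))
    (∑-zero (range s l) (λ _ → refl))

  ∑-range-indicator : ∀ b s l (f : ℕ → ℕ) → s ≤ b → b < s + l → ∑ (range s l) (λ a → 𝟙 ⌊ b ℕ.≟ a ⌋ * f a) ≡ f b
  ∑-range-indicator b s zero    f s≤b b<s+0 = ⊥-elim (<⇒≱ b<s+0 (subst (_≤ b) (sym (+-identityʳ s)) s≤b))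
  ∑-range-indicator b s (suc l) f s≤b b<s+l with b ℕ.≟ s
  ... | yes refl = trans (cong₂ _+_ (+-identityʳ (f b)) (∑-range-indicator-absent b (suc b) l f ≤-refl)) (+-identityʳ (f b))
  ... | no b≢s   = ∑-range-indicator b (suc s) l f (≤∧≢⇒< s≤b (b≢s ∘ sym)) (subst (b <_) (+-suc s l) b<s+l)

  signedLetters : ℕ → List ℤ
  signedLetters N = map (λ k → - (ℤ.+ k)) (range 1 N) ++ map ℤ.+_ (range 1 N)

  map-applyUpTo≡range : ∀ (g f : ℕ → ℕ) s l → (∀ i → g (f i) ≡ s + i) → map g (applyUpTo f l) ≡ range s l
  map-applyUpTo≡range g f s zero    gf≗s+ = refl
  map-applyUpTo≡range g f s (suc l) gf≗s+ = cong₂ _∷_ (trans (gf≗s+ 0) (+-identityʳ s))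
    (map-applyUpTo≡range g (f ∘ suc) (suc s) l (λ i → trans (gf≗s+ (suc i)) (+-suc s i)))

  alphabet≡signedLetters : ∀ N → alphabet N ≡ signedLetters N
  alphabet≡signedLetters N = cong (λ xs → map (λ k → - (ℤ.+ k)) xs ++ map ℤ.+_ xs) (map-applyUpTo≡range suc (λ i → i) 1 N (λ _ → refl))

  Letter : ℕ → ℤ → Set
  Letter N x = 1 ≤ ∣ x ∣ × ∣ x ∣ ≤ N

  signedLetters-Letter : ∀ N → All (Letter N) (signedLetters N)
  signedLetters-Letter N = All.++⁺
    (All.map⁺ (All.map (λ {a} (1≤a , a<1+N) → negative-letter a 1≤a a<1+N) (range-bounds 1 N)))
    (All.map⁺ (All.map (λ (1≤a , a<1+N) → 1≤a , ≤-pred a<1+N) (range-bounds 1 N)))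
    where
    negative-letter : ∀ a → 1 ≤ a → a < 1 + N → Letter N (- (ℤ.+ a))
    negative-letter (suc a) _ (s≤s a<N) = s≤s z≤n , a<N

  ∑-signedLetters : ∀ M (F : ℤ → ℕ) → ∑ (signedLetters M) F ≡ ∑ (range 1 M) (λ a → F (- (ℤ.+ a))) + ∑ (range 1 M) (λ a → F (ℤ.+ a))
  ∑-signedLetters M F = trans (∑-++ (map (λ a → - (ℤ.+ a)) (range 1 M)) (map ℤ.+_ (range 1 M)) F)
    (cong₂ _+_ (∑-map (λ a → - (ℤ.+ a)) (range 1 M) F) (∑-map ℤ.+_ (range 1 M) F))

  ∑-signedLetters-indicator : ∀ M t → Letter M t → (g : ℤ → ℕ) → ∑ (signedLetters M) (λ x → 𝟙 ⌊ t ℤ.≟ x ⌋ * g x) ≡ g t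
  ∑-signedLetters-indicator M -[1+ b ] (_ , b<M) g = trans (∑-signedLetters M _) (trans (cong₂ _+_
      (trans (∑-cong (range 1 M) (λ a → cong (λ e → 𝟙 e * g (- (ℤ.+ a)))
                (⌊⌋-⇔ (mk⇔ (λ e → trans (cong ∣_∣ e) (ℤ.∣-i∣≡∣i∣ (ℤ.+ a))) (λ { refl → refl })) (-[1+ b ] ℤ.≟ - (ℤ.+ a)) (suc b ℕ.≟ a))))
        (∑-range-indicator (suc b) 1 M (λ a → g (- (ℤ.+ a))) (s≤s z≤n) (s≤s b<M)))
      (∑-zero (range 1 M) (λ a → cong (λ e → 𝟙 e * g (ℤ.+ a)) (⌊⌋-false (-[1+ b ] ℤ.≟ ℤ.+ a) (λ ())))))
    (+-identityʳ (g -[1+ b ])))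
  ∑-signedLetters-indicator M (ℤ.+ suc b) (_ , b<M) g = trans (∑-signedLetters M _) (cong₂ _+_
      (trans (∑-cong-All (range-bounds 1 M) (λ a (1≤a , _) → cong (λ e → 𝟙 e * g (- (ℤ.+ a)))
                (⌊⌋-false (ℤ.+ suc b ℤ.≟ - (ℤ.+ a)) (positive≢negative a 1≤a))))
        (∑-zero (range 1 M) (λ _ → refl)))
      (trans (∑-cong (range 1 M) (λ a → cong (λ e → 𝟙 e * g (ℤ.+ a)) (⌊⌋-⇔ (mk⇔ (cong ∣_∣) (cong (λ a → ℤ.+ a))) (ℤ.+ suc b ℤ.≟ ℤ.+ a) (suc b ℕ.≟ a))))
        (∑-range-indicator (suc b) 1 M (λ a → g (ℤ.+ a)) (s≤s z≤n) (s≤s b<M))))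
    where
    positive≢negative : ∀ a → 1 ≤ a → ℤ.+ suc b ≢ - (ℤ.+ a)
    positive≢negative (suc a) _ ()

  hasAbs : ℕ → List ℤ → Bool
  hasAbs a w = any (λ y → ⌊ ∣ y ∣ ℕ.≟ a ⌋) w

  distinctAbs : List ℤ → Bool
  distinctAbs []      = true
  distinctAbs (x ∷ w) = not (hasAbs ∣ x ∣ w) ∧ distinctAbs w

  disjointAbs : List ℤ → List ℤ → Bool
  disjointAbs []      v = true
  disjointAbs (x ∷ u) v = not (hasAbs ∣ x ∣ v) ∧ disjointAbs u v

  #distinctAbs : List ℤ → ℕ
  #distinctAbs []      = 0
  #distinctAbs (x ∷ w) = 𝟙 (not (hasAbs ∣ x ∣ w)) + #distinctAbs w

  #missingAbs : ℕ → List ℤ → ℕ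
  #missingAbs N w = ∑ (range 1 N) (λ a → 𝟙 (not (hasAbs a w)))

  #missingAbs+#distinctAbs : ∀ N w → All (Letter N) w → #missingAbs N w + #distinctAbs w ≡ N
  #missingAbs+#distinctAbs N [] [] = trans (+-identityʳ _)
    (trans (∑-const (range 1 N) 1) (trans (*-identityʳ _) (length-range 1 N)))
  #missingAbs+#distinctAbs N (x ∷ w) ((1≤∣x∣ , ∣x∣≤N) ∷ w-letters) = begin
      #missingAbs N (x ∷ w) + (𝟙 (not (hasAbs ∣ x ∣ w)) + #distinctAbs w)
        ≡⟨ +-assoc (#missingAbs N (x ∷ w)) _ _ ⟨
      #missingAbs N (x ∷ w) + 𝟙 (not (hasAbs ∣ x ∣ w)) + #distinctAbs w
        ≡⟨ cong (λ c → #missingAbs N (x ∷ w) + c + #distinctAbs w)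
             (∑-range-indicator ∣ x ∣ 1 N (λ a → 𝟙 (not (hasAbs a w))) 1≤∣x∣ (s≤s ∣x∣≤N)) ⟨
      #missingAbs N (x ∷ w) + ∑ (range 1 N) (λ a → 𝟙 ⌊ ∣ x ∣ ℕ.≟ a ⌋ * 𝟙 (not (hasAbs a w))) + #distinctAbs w
        ≡⟨ cong (_+ #distinctAbs w) (∑-+ (range 1 N) _ _) ⟨
      ∑ (range 1 N) (λ a → 𝟙 (not (⌊ ∣ x ∣ ℕ.≟ a ⌋ ∨ hasAbs a w)) + 𝟙 ⌊ ∣ x ∣ ℕ.≟ a ⌋ * 𝟙 (not (hasAbs a w))) + #distinctAbs w
        ≡⟨ cong (_+ #distinctAbs w) (∑-cong (range 1 N) (λ a → 𝟙-not-∨ ⌊ ∣ x ∣ ℕ.≟ a ⌋ (hasAbs a w))) ⟩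
      #missingAbs N w + #distinctAbs w
        ≡⟨ #missingAbs+#distinctAbs N w w-letters ⟩
      N ∎
    where
    open ≡-Reasoning
    𝟙-not-∨ : ∀ e h → 𝟙 (not (e ∨ h)) + 𝟙 e * 𝟙 (not h) ≡ 𝟙 (not h)
    𝟙-not-∨ true  h = +-identityʳ (𝟙 (not h))
    𝟙-not-∨ false h = +-identityʳ (𝟙 (not h))

  #distinctAbs≤length : ∀ w → #distinctAbs w ≤ length w
  #distinctAbs≤length []      = z≤n
  #distinctAbs≤length (x ∷ w) with hasAbs ∣ x ∣ w
  ... | true  = m≤n⇒m≤1+n (#distinctAbs≤length w)
  ... | false = s≤s (#distinctAbs≤length w)

  distinctAbs⇔#distinctAbs≡length : ∀ w → distinctAbs w ≡ true ⇔ #distinctAbs w ≡ length w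
  distinctAbs⇔#distinctAbs≡length w = mk⇔ (to w) (from w)
    where
    to : ∀ w → distinctAbs w ≡ true → #distinctAbs w ≡ length w
    to []      _ = refl
    to (x ∷ w) d with hasAbs ∣ x ∣ w
    ... | false = cong suc (to w d)
    from : ∀ w → #distinctAbs w ≡ length w → distinctAbs w ≡ true
    from []      _ = refl
    from (x ∷ w) e with hasAbs ∣ x ∣ w
    ... | true  = ⊥-elim (<-irrefl e (s≤s (#distinctAbs≤length w)))
    ... | false = from w (suc-injective e)

  all⇔∑-not≡0 : (p : A → Bool) (xs : List A) → all p xs ≡ true ⇔ ∑ xs (λ x → 𝟙 (not (p x))) ≡ 0
  all⇔∑-not≡0 p xs = mk⇔ (to xs) (from xs)
    where
    to : ∀ xs → all p xs ≡ true → ∑ xs (λ x → 𝟙 (not (p x))) ≡ 0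
    to []       _ = refl
    to (x ∷ xs) e with p x
    ... | true = to xs e
    from : ∀ xs → ∑ xs (λ x → 𝟙 (not (p x))) ≡ 0 → all p xs ≡ true
    from []       _ = refl
    from (x ∷ xs) e with p x
    ... | true = from xs e

  absCovers≡distinctAbs : ∀ n w → length w ≡ n → All (Letter n) w → absCovers n w ≡ distinctAbs w
  absCovers≡distinctAbs n w refl w-letters = ⇔→≡ (mk⇔ covers⇒distinct distinct⇒covers)
    where
    covers⇔ : absCovers n w ≡ true ⇔ #missingAbs n w ≡ 0
    covers⇔ = subst (λ xs → all (λ a → hasAbs a w) xs ≡ true ⇔ #missingAbs n w ≡ 0)
      (sym (map-applyUpTo≡range suc (λ i → i) 1 n (λ _ → refl))) (all⇔∑-not≡0 (λ a → hasAbs a w) (range 1 n))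
    distinct⇔ : distinctAbs w ≡ true ⇔ #distinctAbs w ≡ length w
    distinct⇔ = distinctAbs⇔#distinctAbs≡length w
    missing+distinct : #missingAbs n w + #distinctAbs w ≡ n
    missing+distinct = #missingAbs+#distinctAbs n w w-letters
    covers⇒distinct : absCovers n w ≡ true → distinctAbs w ≡ true
    covers⇒distinct c = Equivalence.from distinct⇔
      (trans (cong (_+ #distinctAbs w) (sym (Equivalence.to covers⇔ c))) missing+distinct)
    distinct⇒covers : distinctAbs w ≡ true → absCovers n w ≡ true
    distinct⇒covers d = Equivalence.from covers⇔
      (+-cancelʳ-≡ (#distinctAbs w) _ 0 (trans missing+distinct (sym (Equivalence.to distinct⇔ d))))

  -- Order-preserving relabelling

  skip : ℕ → ℕ → ℕ
  skip zero    b       = suc b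
  skip (suc c) zero    = zero
  skip (suc c) (suc b) = suc (skip c b)

  unskip : ℕ → ℕ → ℕ
  unskip zero    b       = ℕ.pred b
  unskip (suc c) zero    = zero
  unskip (suc c) (suc b) = suc (unskip c b)

  unskip-skip : ∀ c b → unskip c (skip c b) ≡ b
  unskip-skip zero    b       = refl
  unskip-skip (suc c) zero    = refl
  unskip-skip (suc c) (suc b) = cong suc (unskip-skip c b)

  skip-unskip : ∀ c b → b ≢ c → skip c (unskip c b) ≡ b
  skip-unskip zero    zero    b≢c = ⊥-elim (b≢c refl)
  skip-unskip zero    (suc b) b≢c = refl
  skip-unskip (suc c) zero    b≢c = refl
  skip-unskip (suc c) (suc b) b≢c = cong suc (skip-unskip c b (b≢c ∘ cong suc))

  skip-injective : ∀ c {a b} → skip c a ≡ skip c b → a ≡ b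
  skip-injective c {a} {b} e = trans (sym (unskip-skip c a)) (trans (cong (unskip c) e) (unskip-skip c b))

  unskip-injective : ∀ c {a b} → a ≢ c → b ≢ c → unskip c a ≡ unskip c b → a ≡ b
  unskip-injective c {a} {b} a≢c b≢c e = trans (sym (skip-unskip c a a≢c)) (trans (cong (skip c) e) (skip-unskip c b b≢c))

  skip-mono-< : ∀ c {a b} → a < b → skip c a < skip c b
  skip-mono-< zero    a<b             = s<s a<b
  skip-mono-< (suc c) {zero}  {suc b} _         = s≤s z≤n
  skip-mono-< (suc c) {suc a} {suc b} (s<s a<b) = s<s (skip-mono-< c a<b)

  skip-< : ∀ c b → b < c → skip c b ≡ b
  skip-< (suc c) zero    _         = refl
  skip-< (suc c) (suc b) (s<s b<c) = cong suc (skip-< c b b<c)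

  skip-≥ : ∀ c b → c ≤ b → skip c b ≡ suc b
  skip-≥ zero    b       _         = refl
  skip-≥ (suc c) (suc b) (s≤s c≤b) = cong suc (skip-≥ c b c≤b)

  unskip-< : ∀ c b N → b ≢ c → b ≤ N → c ≤ N → unskip c b < N
  unskip-< zero    zero    N       b≢c _         _         = ⊥-elim (b≢c refl)
  unskip-< zero    (suc b) N       _   b<N       _         = b<N
  unskip-< (suc c) zero    N       _   _         c<N       = ≤-trans (s≤s z≤n) c<N
  unskip-< (suc c) (suc b) (suc N) b≢c (s≤s b≤N) (s≤s c≤N) = s<s (unskip-< c b N (b≢c ∘ cong suc) b≤N c≤N)

  -- skipAbs c embeds the signed letters of [N] into those of [N + 1], skipping the absolute
  -- value c + 1; unskipAbs c inverts it away from ±(c + 1).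
  skipAbs : ℕ → ℤ → ℤ
  skipAbs c (ℤ.+ b)  = ℤ.+ skip (suc c) b
  skipAbs c -[1+ b ] = -[1+ skip c b ]

  unskipAbs : ℕ → ℤ → ℤ
  unskipAbs c (ℤ.+ b)  = ℤ.+ unskip (suc c) b
  unskipAbs c -[1+ b ] = -[1+ unskip c b ]

  ∣skipAbs∣ : ∀ c x → ∣ skipAbs c x ∣ ≡ skip (suc c) ∣ x ∣
  ∣skipAbs∣ c (ℤ.+ b)  = refl
  ∣skipAbs∣ c -[1+ b ] = refl

  ∣unskipAbs∣ : ∀ c x → ∣ unskipAbs c x ∣ ≡ unskip (suc c) ∣ x ∣
  ∣unskipAbs∣ c (ℤ.+ b)  = refl
  ∣unskipAbs∣ c -[1+ b ] = refl

  skipAbs-neg : ∀ c k → skipAbs c (- (ℤ.+ k)) ≡ - (ℤ.+ skip (suc c) k)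
  skipAbs-neg c zero    = refl
  skipAbs-neg c (suc k) = refl

  skipAbs-mono-< : ∀ c → skipAbs c Preserves ℤ._<_ ⟶ ℤ._<_
  skipAbs-mono-< c (ℤ.-<- b<a) = ℤ.-<- (skip-mono-< c b<a)
  skipAbs-mono-< c ℤ.-<+       = ℤ.-<+
  skipAbs-mono-< c (ℤ.+<+ a<b) = ℤ.+<+ (skip-mono-< (suc c) a<b)

  Letter-unskipAbs : ∀ c N y → Letter (suc N) y → ∣ y ∣ ≢ suc c → c ≤ N → Letter N (unskipAbs c y)
  Letter-unskipAbs c N y (1≤∣y∣ , ∣y∣≤1+N) ∣y∣≢1+c c≤N rewrite ∣unskipAbs∣ c y = lower ∣ y ∣ 1≤∣y∣ ∣y∣≤1+N ∣y∣≢1+c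
    where
    lower : ∀ b → 1 ≤ b → b ≤ suc N → b ≢ suc c → 1 ≤ unskip (suc c) b × unskip (suc c) b ≤ N
    lower (suc b) _ (s≤s b≤N) b≢1+c = s≤s z≤n , unskip-< c b N (b≢1+c ∘ cong suc) b≤N c≤N

  ⌊<?⌋-preserved : ∀ {f : ℤ → ℤ} → f Preserves ℤ._<_ ⟶ ℤ._<_ → ∀ x y → ⌊ f x ℤ.<? f y ⌋ ≡ ⌊ x ℤ.<? y ⌋
  ⌊<?⌋-preserved {f} f-mono x y = ⌊⌋-⇔ (mk⇔ reflect f-mono) (f x ℤ.<? f y) (x ℤ.<? y)
    where
    reflect : f x ℤ.< f y → x ℤ.< y
    reflect fx<fy with ℤ.<-cmp x y
    ... | tri< x<y _ _ = x<y
    ... | tri≈ _ refl _ = ⊥-elim (ℤ.<-irrefl refl fx<fy)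
    ... | tri> _ _ y<x = ⊥-elim (ℤ.<-asym fx<fy (f-mono y<x))

  hasAbs-map : (f : ℤ → ℤ) (a b : ℕ) {P : ℤ → Set} → (∀ y → P y → ∣ f y ∣ ≡ b ⇔ ∣ y ∣ ≡ a) →
    ∀ {w} → All P w → hasAbs b (map f w) ≡ hasAbs a w
  hasAbs-map f a b f-abs []         = refl
  hasAbs-map f a b f-abs (py ∷ pw) = cong₂ _∨_ (⌊⌋-⇔ (f-abs _ py) _ _) (hasAbs-map f a b f-abs pw)

  distinctAbs-skipAbs : ∀ c w → distinctAbs (map (skipAbs c) w) ≡ distinctAbs w
  distinctAbs-skipAbs c []      = refl
  distinctAbs-skipAbs c (x ∷ w) = cong₂ (λ h d → not h ∧ d)
    (hasAbs-map (skipAbs c) ∣ x ∣ ∣ skipAbs c x ∣ (λ y _ → mk⇔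
       (λ e → skip-injective (suc c) (trans (sym (∣skipAbs∣ c y)) (trans e (∣skipAbs∣ c x))))
       (λ e → trans (∣skipAbs∣ c y) (trans (cong (skip (suc c)) e) (sym (∣skipAbs∣ c x)))))
      (All.universal (λ _ → tt) w))
    (distinctAbs-skipAbs c w)

  AvoidsAbs : ℕ → List ℤ → Set
  AvoidsAbs a = All (λ y → ∣ y ∣ ≢ a)

  hasAbs≡false⇒AvoidsAbs : ∀ a w → hasAbs a w ≡ false → AvoidsAbs a w
  hasAbs≡false⇒AvoidsAbs a []      _ = []
  hasAbs≡false⇒AvoidsAbs a (y ∷ w) h with ∣ y ∣ ℕ.≟ a
  ... | no ∣y∣≢a = ∣y∣≢a ∷ hasAbs≡false⇒AvoidsAbs a w h

  disjointAbs-skipAbs : ∀ c u v → AvoidsAbs (suc c) u →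
    disjointAbs u (map (skipAbs c) v) ≡ disjointAbs (map (unskipAbs c) u) v
  disjointAbs-skipAbs c []      v []             = refl
  disjointAbs-skipAbs c (y ∷ u) v (∣y∣≢ ∷ u-avoids) = cong₂ (λ h d → not h ∧ d)
    (hasAbs-map (skipAbs c) ∣ unskipAbs c y ∣ ∣ y ∣ (λ z _ → mk⇔
       (λ e → trans (sym (unskip-skip (suc c) ∣ z ∣))
                (trans (cong (unskip (suc c)) (trans (sym (∣skipAbs∣ c z)) e)) (sym (∣unskipAbs∣ c y))))
       (λ e → trans (∣skipAbs∣ c z)
                (trans (cong (skip (suc c)) (trans e (∣unskipAbs∣ c y))) (skip-unskip (suc c) ∣ y ∣ ∣y∣≢))))
      (All.universal (λ _ → tt) v))
    (disjointAbs-skipAbs c u v u-avoids)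

  distinctAbs-unskipAbs : ∀ c u → AvoidsAbs (suc c) u → distinctAbs (map (unskipAbs c) u) ≡ distinctAbs u
  distinctAbs-unskipAbs c []      []             = refl
  distinctAbs-unskipAbs c (y ∷ u) (∣y∣≢ ∷ u-avoids) = cong₂ (λ h d → not h ∧ d)
    (hasAbs-map (unskipAbs c) ∣ y ∣ ∣ unskipAbs c y ∣ (λ z ∣z∣≢ → mk⇔
       (λ e → unskip-injective (suc c) ∣z∣≢ ∣y∣≢ (trans (sym (∣unskipAbs∣ c z)) (trans e (∣unskipAbs∣ c y))))
       (λ e → trans (∣unskipAbs∣ c z) (trans (cong (unskip (suc c)) e) (sym (∣unskipAbs∣ c y)))))
      u-avoids)
    (distinctAbs-unskipAbs c u u-avoids)

  filterᵇ-≢-range : ∀ a s l → s ≤ a → a ≤ s + l →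
    filterᵇ (λ b → not ⌊ b ℕ.≟ a ⌋) (range s (suc l)) ≡ map (skip a) (range s l)
  filterᵇ-≢-range a s l s≤a a≤s+l with s ℕ.≟ a
  ... | yes refl = trans (keep-all (suc s) l ≤-refl) (sym (shift-all s l ≤-refl))
    where
    keep-all : ∀ s′ l → a < s′ → filterᵇ (λ b → not ⌊ b ℕ.≟ a ⌋) (range s′ l) ≡ range s′ l
    keep-all s′ zero    _    = refl
    keep-all s′ (suc l) a<s′ rewrite ⌊⌋-false (s′ ℕ.≟ a) (λ { refl → <-irrefl refl a<s′ }) =
      cong (s′ ∷_) (keep-all (suc s′) l (m<n⇒m<1+n a<s′))
    shift-all : ∀ s′ l → a ≤ s′ → map (skip a) (range s′ l) ≡ range (suc s′) l
    shift-all s′ zero    _    = refl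
    shift-all s′ (suc l) a≤s′ = cong₂ _∷_ (skip-≥ a s′ a≤s′) (shift-all (suc s′) l (m≤n⇒m≤1+n a≤s′))
  filterᵇ-≢-range a s zero    s≤a a≤s+0 | no s≢a = ⊥-elim (s≢a (≤-antisym s≤a (subst (a ≤_) (+-identityʳ s) a≤s+0)))
  filterᵇ-≢-range a s (suc l) s≤a a≤s+l | no s≢a = cong₂ _∷_ (sym (skip-< a s s<a))
    (filterᵇ-≢-range a (suc s) l s<a (subst (a ≤_) (+-suc s l) a≤s+l))
    where
    s<a : s < a
    s<a = ≤∧≢⇒< s≤a s≢a

  absDiffers : ℕ → ℤ → Bool
  absDiffers a y = not ⌊ ∣ y ∣ ℕ.≟ a ⌋

  not-hasAbs≡all : ∀ a w → not (hasAbs a w) ≡ all (absDiffers a) w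
  not-hasAbs≡all a []      = refl
  not-hasAbs≡all a (y ∷ w) with ⌊ ∣ y ∣ ℕ.≟ a ⌋
  ... | true  = refl
  ... | false = not-hasAbs≡all a w

  filterᵇ-signedLetters : ∀ c N → c ≤ N →
    filterᵇ (absDiffers (suc c)) (signedLetters (suc N)) ≡ map (skipAbs c) (signedLetters N)
  filterᵇ-signedLetters c N c≤N = begin
      filterᵇ (absDiffers a) (map neg R₁ ++ map ℤ.+_ R₁)
        ≡⟨ filterᵇ-++ (absDiffers a) (map neg R₁) (map ℤ.+_ R₁) ⟩
      filterᵇ (absDiffers a) (map neg R₁) ++ filterᵇ (absDiffers a) (map ℤ.+_ R₁)
        ≡⟨ cong₂ _++_ (filterᵇ-map (absDiffers a) neg R₁) (filterᵇ-map (absDiffers a) ℤ.+_ R₁) ⟩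
      map neg (filterᵇ (absDiffers a ∘ neg) R₁) ++ map ℤ.+_ (filterᵇ (absDiffers a ∘ ℤ.+_) R₁)
        ≡⟨ cong (λ xs → map neg xs ++ map ℤ.+_ (filterᵇ (absDiffers a ∘ ℤ.+_) R₁))
             (filterᵇ-cong (λ b → cong (λ t → not ⌊ t ℕ.≟ a ⌋) (ℤ.∣-i∣≡∣i∣ (ℤ.+ b))) R₁) ⟩
      map neg (filterᵇ (λ b → not ⌊ b ℕ.≟ a ⌋) R₁) ++ map ℤ.+_ (filterᵇ (λ b → not ⌊ b ℕ.≟ a ⌋) R₁)
        ≡⟨ cong (λ xs → map neg xs ++ map ℤ.+_ xs) (filterᵇ-≢-range a 1 N (s≤s z≤n) (s≤s c≤N)) ⟩
      map neg (map (skip a) R₀) ++ map ℤ.+_ (map (skip a) R₀)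
        ≡⟨ cong₂ _++_ (trans (sym (map-∘ R₀)) (trans (map-cong (λ b → sym (skipAbs-neg c b)) R₀) (map-∘ R₀)))
                      (trans (sym (map-∘ R₀)) (map-∘ R₀)) ⟩
      map (skipAbs c) (map neg R₀) ++ map (skipAbs c) (map ℤ.+_ R₀)
        ≡⟨ map-++ (skipAbs c) (map neg R₀) (map ℤ.+_ R₀) ⟨
      map (skipAbs c) (signedLetters N) ∎
    where
    open ≡-Reasoning
    a : ℕ
    a = suc c
    R₁ R₀ : List ℕ
    R₁ = range 1 (suc N)
    R₀ = range 1 N
    neg : ℕ → ℤ
    neg k = - (ℤ.+ k)

  -- Counting words with distinct absolute values

  count : (List ℤ → Bool) → ℕ → ℕ → ℕ
  count Φ k N = ∑ (words k (signedLetters N)) (λ v → 𝟙 (distinctAbs v ∧ Φ v))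

  SkipInvariant : (List ℤ → Bool) → Set
  SkipInvariant Φ = ∀ c w → Φ (map (skipAbs c) w) ≡ Φ w

  ∑-words-avoiding : ∀ k c N → c ≤ N → (F : List ℤ → ℕ) →
    ∑ (words k (signedLetters (suc N))) (λ v → 𝟙 (not (hasAbs (suc c) v)) * F v)
      ≡ ∑ (words k (signedLetters N)) (F ∘ map (skipAbs c))
  ∑-words-avoiding k c N c≤N F = begin
      ∑ (words k (signedLetters (suc N))) (λ v → 𝟙 (not (hasAbs (suc c) v)) * F v)
        ≡⟨ ∑-cong (words k _) (λ v → cong (λ b → 𝟙 b * F v) (not-hasAbs≡all (suc c) v)) ⟩
      ∑ (words k (signedLetters (suc N))) (λ v → 𝟙 (all (absDiffers (suc c)) v) * F v)
        ≡⟨ ∑-words-filterᵇ k (absDiffers (suc c)) (signedLetters (suc N)) F ⟨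
      ∑ (words k (filterᵇ (absDiffers (suc c)) (signedLetters (suc N)))) F
        ≡⟨ cong (λ xs → ∑ (words k xs) F) (filterᵇ-signedLetters c N c≤N) ⟩
      ∑ (words k (map (skipAbs c) (signedLetters N))) F
        ≡⟨ ∑-words-map k (skipAbs c) (signedLetters N) F ⟩
      ∑ (words k (signedLetters N)) (F ∘ map (skipAbs c)) ∎
    where open ≡-Reasoning

  ∑-disjointAbs≡count : ∀ {Φ} → SkipInvariant Φ → ∀ k N u → distinctAbs u ≡ true → All (Letter N) u →
    ∑ (words k (signedLetters N)) (λ v → 𝟙 (disjointAbs u v) * 𝟙 (distinctAbs v ∧ Φ v)) ≡ count Φ k (N ∸ length u)
  ∑-disjointAbs≡count Φ-inv k N []      _ _ = ∑-cong (words k (signedLetters N)) (λ v → +-identityʳ _)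
  ∑-disjointAbs≡count Φ-inv k zero    (x ∷ u) _ ((1≤∣x∣ , ∣x∣≤0) ∷ _) = ⊥-elim (<⇒≱ 1≤∣x∣ ∣x∣≤0)
  ∑-disjointAbs≡count {Φ} Φ-inv k (suc N) (x ∷ u) distinct ((1≤∣x∣ , ∣x∣≤1+N) ∷ u-letters) =
    remove-head (ℕ.pred ∣ x ∣) (sym (suc-pred ∣ x ∣ {{ℕ.>-nonZero 1≤∣x∣}}))
    where
    g : List ℤ → ℕ
    g v = 𝟙 (distinctAbs v ∧ Φ v)
    remove-head : ∀ c → ∣ x ∣ ≡ suc c →
      ∑ (words k (signedLetters (suc N))) (λ v → 𝟙 (disjointAbs (x ∷ u) v) * g v) ≡ count Φ k (N ∸ length u)
    remove-head c ∣x∣≡1+c = begin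
        ∑ (words k (signedLetters (suc N))) (λ v → 𝟙 (disjointAbs (x ∷ u) v) * g v)
          ≡⟨ ∑-cong (words k _) (λ v → trans (cong (λ a → 𝟙 (not (hasAbs a v) ∧ disjointAbs u v) * g v) ∣x∣≡1+c)
               (trans (cong (_* g v) (𝟙-∧ (not (hasAbs (suc c) v)) (disjointAbs u v))) (*-assoc (𝟙 (not (hasAbs (suc c) v))) _ (g v)))) ⟩
        ∑ (words k (signedLetters (suc N))) (λ v → 𝟙 (not (hasAbs (suc c) v)) * (𝟙 (disjointAbs u v) * g v))
          ≡⟨ ∑-words-avoiding k c N (≤-pred (subst (_≤ suc N) ∣x∣≡1+c ∣x∣≤1+N)) (λ v → 𝟙 (disjointAbs u v) * g v) ⟩
        ∑ (words k (signedLetters N)) (λ v → 𝟙 (disjointAbs u (map (skipAbs c) v)) * g (map (skipAbs c) v))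
          ≡⟨ ∑-cong (words k _) (λ v → cong₂ (λ d e → 𝟙 d * 𝟙 e) (disjointAbs-skipAbs c u v u-avoids)
               (cong₂ _∧_ (distinctAbs-skipAbs c v) (Φ-inv c v))) ⟩
        ∑ (words k (signedLetters N)) (λ v → 𝟙 (disjointAbs (map (unskipAbs c) u) v) * g v)
          ≡⟨ ∑-disjointAbs≡count Φ-inv k N (map (unskipAbs c) u) (trans (distinctAbs-unskipAbs c u u-avoids) distinct-u) u′-letters ⟩
        count Φ k (N ∸ length (map (unskipAbs c) u))
          ≡⟨ cong (λ l → count Φ k (N ∸ l)) (length-map (unskipAbs c) u) ⟩
        count Φ k (N ∸ length u) ∎
      where
      open ≡-Reasoning
      distinct-u : distinctAbs u ≡ true
      distinct-u = ∧-conicalʳ _ _ distinct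
      u-avoids : AvoidsAbs (suc c) u
      u-avoids = subst (λ a → AvoidsAbs a u) ∣x∣≡1+c (hasAbs≡false⇒AvoidsAbs ∣ x ∣ u (not-injective (∧-conicalˡ _ _ distinct)))
      u′-letters : All (Letter N) (map (unskipAbs c) u)
      u′-letters = All.map⁺ (All.zipWith (λ {y} (ℓ , a) → Letter-unskipAbs c N y ℓ a (≤-pred (subst (_≤ suc N) ∣x∣≡1+c ∣x∣≤1+N))) (u-letters , u-avoids))

  [k+1]*[n+1]C[k+1]≡[n+1]*nCk : ∀ n k → suc k * (suc n C suc k) ≡ suc n * (n C k)
  [k+1]*[n+1]C[k+1]≡[n+1]*nCk n       zero    = trans (+-identityʳ _) (trans (nC1≡n (suc n)) (sym (*-identityʳ (suc n))))
  [k+1]*[n+1]C[k+1]≡[n+1]*nCk zero    (suc k) = *-zeroʳ (suc (suc k))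
  [k+1]*[n+1]C[k+1]≡[n+1]*nCk (suc n) (suc k) = begin
      suc (suc k) * (suc (suc n) C suc (suc k))
        ≡⟨ cong (suc (suc k) *_) (nCk+nC[k+1]≡[n+1]C[k+1] (suc n) (suc k)) ⟨
      suc (suc k) * (a + b)
        ≡⟨ distribute a b (suc k) ⟩
      a + suc k * a + suc (suc k) * b
        ≡⟨ cong₂ (λ x y → a + x + y) ([k+1]*[n+1]C[k+1]≡[n+1]*nCk n k) ([k+1]*[n+1]C[k+1]≡[n+1]*nCk n (suc k)) ⟩
      a + suc n * (n C k) + suc n * (n C suc k)
        ≡⟨ +-assoc a _ _ ⟩
      a + (suc n * (n C k) + suc n * (n C suc k))
        ≡⟨ cong (a +_) (*-distribˡ-+ (suc n) (n C k) (n C suc k)) ⟨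
      a + suc n * (n C k + n C suc k)
        ≡⟨ cong (λ x → a + suc n * x) (nCk+nC[k+1]≡[n+1]C[k+1] n k) ⟩
      suc (suc n) * a ∎
    where
    open ≡-Reasoning
    a b : ℕ
    a = suc n C suc k
    b = suc n C suc (suc k)
    distribute : ∀ a b k → suc k * (a + b) ≡ a + k * a + suc k * b
    distribute = solve-∀

  [n+1∸k]*[n+1]Ck≡[n+1]*nCk : ∀ n k → k ≤ n → (suc n ∸ k) * (suc n C k) ≡ suc n * (n C k)
  [n+1∸k]*[n+1]Ck≡[n+1]*nCk n zero    _   = refl
  [n+1∸k]*[n+1]Ck≡[n+1]*nCk n (suc k) k<n = +-cancelʳ-≡ (suc n * (n C k)) _ _ (begin
      (n ∸ k) * x + suc n * (n C k)
        ≡⟨ cong ((n ∸ k) * x +_) ([k+1]*[n+1]C[k+1]≡[n+1]*nCk n k) ⟨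
      (n ∸ k) * x + suc k * x
        ≡⟨ *-distribʳ-+ x (n ∸ k) (suc k) ⟨
      (n ∸ k + suc k) * x
        ≡⟨ cong (_* x) (trans (+-suc (n ∸ k) k) (cong suc (m∸n+n≡m (<⇒≤ k<n)))) ⟩
      suc n * x
        ≡⟨ cong (suc n *_) (nCk+nC[k+1]≡[n+1]C[k+1] n k) ⟨
      suc n * (n C k + n C suc k)
        ≡⟨ *-distribˡ-+ (suc n) (n C k) (n C suc k) ⟩
      suc n * (n C k) + suc n * (n C suc k)
        ≡⟨ +-comm (suc n * (n C k)) _ ⟩
      suc n * (n C suc k) + suc n * (n C k) ∎)
    where
    open ≡-Reasoning
    x : ℕ
    x = suc n C suc k

  #missingAbs-distinct : ∀ N v → All (Letter N) v → distinctAbs v ≡ true → #missingAbs N v ≡ N ∸ length v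
  #missingAbs-distinct N v v-letters distinct = trans (sym (m+n∸n≡m (#missingAbs N v) (length v)))
    (cong (_∸ length v) (trans (cong (#missingAbs N v +_) (sym (Equivalence.to (distinctAbs⇔#distinctAbs≡length v) distinct)))
      (#missingAbs+#distinctAbs N v v-letters)))

  -- Double counting of the pairs (a , v) where a ∈ [1, N + 1] is an absolute value missing from v.
  count-suc : ∀ {Φ} → SkipInvariant Φ → ∀ k N → (suc N ∸ k) * count Φ k (suc N) ≡ suc N * count Φ k N
  count-suc {Φ} Φ-inv k N = sym (begin
      suc N * count Φ k N
        ≡⟨ trans (∑-const (range 1 (suc N)) (count Φ k N)) (cong (_* count Φ k N) (length-range 1 (suc N))) ⟨
      ∑ (range 1 (suc N)) (λ a → count Φ k N)
        ≡⟨ ∑-cong-All (range-bounds 1 (suc N)) (λ a (1≤a , a≤1+N) → trans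
             (∑-cong W (λ v → cong (λ b → 𝟙 b * g v) (sym (∧-identityʳ (not (hasAbs a v))))))
             (∑-disjointAbs≡count Φ-inv k (suc N) (ℤ.+ a ∷ []) refl ((1≤a , ≤-pred a≤1+N) ∷ []))) ⟨
      ∑ (range 1 (suc N)) (λ a → ∑ W (λ v → 𝟙 (not (hasAbs a v)) * g v))
        ≡⟨ ∑-comm W (range 1 (suc N)) (λ v a → 𝟙 (not (hasAbs a v)) * g v) ⟨
      ∑ W (λ v → ∑ (range 1 (suc N)) (λ a → 𝟙 (not (hasAbs a v)) * g v))
        ≡⟨ ∑-cong W (λ v → ∑-*ʳ (range 1 (suc N)) (g v) (λ a → 𝟙 (not (hasAbs a v)))) ⟩
      ∑ W (λ v → #missingAbs (suc N) v * g v)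
        ≡⟨ ∑-words-cong k (signedLetters-Letter (suc N)) (λ v |v|≡k v-letters → missing-term v |v|≡k v-letters) ⟩
      ∑ W (λ v → (suc N ∸ k) * g v)
        ≡⟨ ∑-*ˡ W (suc N ∸ k) g ⟩
      (suc N ∸ k) * count Φ k (suc N) ∎)
    where
    open ≡-Reasoning
    W : List (List ℤ)
    W = words k (signedLetters (suc N))
    g : List ℤ → ℕ
    g v = 𝟙 (distinctAbs v ∧ Φ v)
    missing-term : ∀ v → length v ≡ k → All (Letter (suc N)) v → #missingAbs (suc N) v * g v ≡ (suc N ∸ k) * g v
    missing-term v |v|≡k v-letters with distinctAbs v in distinct
    ... | true  = cong (_* 𝟙 (Φ v)) (trans (#missingAbs-distinct (suc N) v v-letters distinct) (cong (suc N ∸_) |v|≡k))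
    ... | false = trans (*-zeroʳ (#missingAbs (suc N) v)) (sym (*-zeroʳ (suc N ∸ k)))

  count≡C*count : ∀ {Φ} → SkipInvariant Φ → ∀ k N → k ≤ N → count Φ k N ≡ (N C k) * count Φ k k
  count≡C*count {Φ} Φ-inv k N k≤N = subst (λ N → count Φ k N ≡ (N C k) * count Φ k k) (m∸n+n≡m k≤N) (go (N ∸ k))
    where
    open ≡-Reasoning
    go : ∀ d → count Φ k (d + k) ≡ ((d + k) C k) * count Φ k k
    go zero    = sym (trans (cong (_* count Φ k k) (nCn≡1 k)) (+-identityʳ _))
    go (suc d) = *-cancelˡ-≡ _ _ (suc d) (begin
        suc d * count Φ k (suc n)
          ≡⟨ cong (_* count Φ k (suc n)) (m+n∸n≡m (suc d) k) ⟨
        (suc n ∸ k) * count Φ k (suc n)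
          ≡⟨ count-suc Φ-inv k n ⟩
        suc n * count Φ k n
          ≡⟨ cong (suc n *_) (go d) ⟩
        suc n * ((n C k) * count Φ k k)
          ≡⟨ *-assoc (suc n) (n C k) (count Φ k k) ⟨
        suc n * (n C k) * count Φ k k
          ≡⟨ cong (_* count Φ k k) ([n+1∸k]*[n+1]Ck≡[n+1]*nCk n k (m≤n+m k d)) ⟨
        (suc n ∸ k) * (suc n C k) * count Φ k k
          ≡⟨ cong (λ x → x * (suc n C k) * count Φ k k) (m+n∸n≡m (suc d) k) ⟩
        suc d * (suc n C k) * count Φ k k
          ≡⟨ *-assoc (suc d) (suc n C k) (count Φ k k) ⟩
        suc d * ((suc n C k) * count Φ k k) ∎)
      where
      n : ℕ
      n = d + k

  count-length>alphabet : ∀ Φ k → count Φ (suc k) k ≡ 0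
  count-length>alphabet Φ k = trans (∑-words-cong (suc k) (signedLetters-Letter k) vanish)
    (∑-zero (words (suc k) (signedLetters k)) {λ _ → 0} (λ _ → refl))
    where
    vanish : ∀ v → length v ≡ suc k → All (Letter k) v → 𝟙 (distinctAbs v ∧ Φ v) ≡ 0
    vanish v |v|≡1+k v-letters with distinctAbs v in distinct
    ... | false = refl
    ... | true  = ⊥-elim (<-irrefl refl (subst (_≤ k)
      (trans (Equivalence.to (distinctAbs⇔#distinctAbs≡length v) distinct) |v|≡1+k)
      (subst (#distinctAbs v ≤_) (#missingAbs+#distinctAbs k v v-letters) (m≤n+m (#distinctAbs v) (#missingAbs k v)))))

  distinctAbs-++ : ∀ u v → distinctAbs (u ++ v) ≡ distinctAbs u ∧ (disjointAbs u v ∧ distinctAbs v)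
  distinctAbs-++ []      v = refl
  distinctAbs-++ (x ∷ u) v = trans
    (cong₂ (λ h d → not h ∧ d) (any-++ (λ y → ⌊ ∣ y ∣ ℕ.≟ ∣ x ∣ ⌋) u v) (distinctAbs-++ u v))
    (regroup (hasAbs ∣ x ∣ u) (hasAbs ∣ x ∣ v) (distinctAbs u) (disjointAbs u v) (distinctAbs v))
    where
    regroup : ∀ p r d a e → not (p ∨ r) ∧ (d ∧ (a ∧ e)) ≡ (not p ∧ d) ∧ ((not r ∧ a) ∧ e)
    regroup true  r     d     a e = refl
    regroup false true  true  a e = refl
    regroup false true  false a e = refl
    regroup false false d     a e = refl

  count*count : ∀ (Φ₁ : List ℤ → Bool) {Φ₂} → SkipInvariant Φ₂ → ∀ j k N →
    ∑ (words j (signedLetters N)) (λ u → ∑ (words k (signedLetters N)) (λ v → 𝟙 (distinctAbs (u ++ v) ∧ (Φ₁ u ∧ Φ₂ v))))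
      ≡ count Φ₁ j N * count Φ₂ k (N ∸ j)
  count*count Φ₁ {Φ₂} Φ₂-inv j k N = trans (∑-words-cong j (signedLetters-Letter N) inner)
    (∑-*ʳ (words j (signedLetters N)) (count Φ₂ k (N ∸ j)) (λ u → 𝟙 (distinctAbs u ∧ Φ₁ u)))
    where
    split : ∀ d a e f g → 𝟙 ((d ∧ (a ∧ e)) ∧ (f ∧ g)) ≡ 𝟙 (d ∧ f) * (𝟙 a * 𝟙 (e ∧ g))
    split true  true  e     true  g = sym (trans (+-identityʳ _) (+-identityʳ _))
    split true  true  true  false g = refl
    split true  true  false false g = refl
    split true  false e     f     g = sym (*-zeroʳ (𝟙 f))
    split false a     e     f     g = refl
    inner : ∀ u → length u ≡ j → All (Letter N) u →
      ∑ (words k (signedLetters N)) (λ v → 𝟙 (distinctAbs (u ++ v) ∧ (Φ₁ u ∧ Φ₂ v))) ≡ 𝟙 (distinctAbs u ∧ Φ₁ u) * count Φ₂ k (N ∸ j)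
    inner u |u|≡j u-letters = begin
        ∑ (words k (signedLetters N)) (λ v → 𝟙 (distinctAbs (u ++ v) ∧ (Φ₁ u ∧ Φ₂ v)))
          ≡⟨ ∑-cong (words k _) (λ v → trans (cong (λ b → 𝟙 (b ∧ (Φ₁ u ∧ Φ₂ v))) (distinctAbs-++ u v))
               (split (distinctAbs u) (disjointAbs u v) (distinctAbs v) (Φ₁ u) (Φ₂ v))) ⟩
        ∑ (words k (signedLetters N)) (λ v → 𝟙 (distinctAbs u ∧ Φ₁ u) * (𝟙 (disjointAbs u v) * 𝟙 (distinctAbs v ∧ Φ₂ v)))
          ≡⟨ ∑-*ˡ (words k _) (𝟙 (distinctAbs u ∧ Φ₁ u)) _ ⟩
        𝟙 (distinctAbs u ∧ Φ₁ u) * ∑ (words k (signedLetters N)) (λ v → 𝟙 (disjointAbs u v) * 𝟙 (distinctAbs v ∧ Φ₂ v))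
          ≡⟨ guarded (distinctAbs u) (Φ₁ u) (λ d → trans (∑-disjointAbs≡count Φ₂-inv k N u d u-letters)
               (cong (λ l → count Φ₂ k (N ∸ l)) |u|≡j)) ⟩
        𝟙 (distinctAbs u ∧ Φ₁ u) * count Φ₂ k (N ∸ j) ∎
      where
      open ≡-Reasoning
      guarded : ∀ b c {x y} → (b ≡ true → x ≡ y) → 𝟙 (b ∧ c) * x ≡ 𝟙 (b ∧ c) * y
      guarded true  c x≡y = cong (𝟙 c *_) (x≡y refl)
      guarded false c x≡y = refl

  ascending : List ℤ → Bool
  ascending (x ∷ y ∷ r) = ⌊ x ℤ.<? y ⌋ ∧ ascending (y ∷ r)
  ascending _           = true

  descending : List ℤ → Bool
  descending (x ∷ y ∷ r) = ⌊ y ℤ.<? x ⌋ ∧ descending (y ∷ r)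
  descending _           = true

  isPeak : ℤ → ℤ → ℤ → Bool
  isPeak a b c = ⌊ a ℤ.<? b ⌋ ∧ ⌊ c ℤ.<? b ⌋

  peakFree : List ℤ → Bool
  peakFree (a ∷ b ∷ c ∷ r) = not (isPeak a b c) ∧ peakFree (b ∷ c ∷ r)
  peakFree _               = true

  module _ {f : ℤ → ℤ} (f-mono : f Preserves ℤ._<_ ⟶ ℤ._<_) where

    private
      f<f : ∀ x y → ⌊ f x ℤ.<? f y ⌋ ≡ ⌊ x ℤ.<? y ⌋
      f<f = ⌊<?⌋-preserved f-mono

    ascending-map : ∀ w → ascending (map f w) ≡ ascending w
    ascending-map []          = refl
    ascending-map (a ∷ [])    = refl
    ascending-map (a ∷ b ∷ r) = cong₂ _∧_ (f<f a b) (ascending-map (b ∷ r))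

    descending-map : ∀ w → descending (map f w) ≡ descending w
    descending-map []          = refl
    descending-map (a ∷ [])    = refl
    descending-map (a ∷ b ∷ r) = cong₂ _∧_ (f<f b a) (descending-map (b ∷ r))

    peakFree-map : ∀ w → peakFree (map f w) ≡ peakFree w
    peakFree-map []              = refl
    peakFree-map (a ∷ [])        = refl
    peakFree-map (a ∷ b ∷ [])    = refl
    peakFree-map (a ∷ b ∷ c ∷ r) = cong₂ (λ p q → not p ∧ q) (cong₂ _∧_ (f<f a b) (f<f c b)) (peakFree-map (b ∷ c ∷ r))

    peaksFrom-map : ∀ i w → peaksFrom i (map f w) ≡ peaksFrom i w
    peaksFrom-map i []              = refl
    peaksFrom-map i (a ∷ [])        = refl
    peaksFrom-map i (a ∷ b ∷ [])    = refl
    peaksFrom-map i (a ∷ b ∷ c ∷ r) = cong₂ (λ p P → if p then suc i ∷ P else P)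
      (cong₂ _∧_ (f<f a b) (f<f c b)) (peaksFrom-map (suc i) (b ∷ c ∷ r))

  ascending-skipInvariant : SkipInvariant ascending
  ascending-skipInvariant c = ascending-map (skipAbs-mono-< c)

  descending-skipInvariant : SkipInvariant descending
  descending-skipInvariant c = descending-map (skipAbs-mono-< c)

  peakFree-skipInvariant : SkipInvariant peakFree
  peakFree-skipInvariant c = peakFree-map (skipAbs-mono-< c)

  -- Signed permutations without peaks

  occurs : ℤ → List ℤ → Bool
  occurs t = any (λ y → ⌊ t ℤ.≟ y ⌋)

  occurs⇒All : ∀ {P : ℤ → Set} t w → occurs t w ≡ true → All P w → P t
  occurs⇒All t (y ∷ w) o (py ∷ pw) with t ℤ.≟ y
  ... | yes refl = py
  ... | no _     = occurs⇒All t w o pw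

  AvoidsAbs⇒¬occurs : ∀ t w → AvoidsAbs ∣ t ∣ w → occurs t w ≡ false
  AvoidsAbs⇒¬occurs t []      []                = refl
  AvoidsAbs⇒¬occurs t (y ∷ w) (∣y∣≢∣t∣ ∷ avoids) =
    cong₂ _∨_ (⌊⌋-false (t ℤ.≟ y) (λ { refl → ∣y∣≢∣t∣ refl })) (AvoidsAbs⇒¬occurs t w avoids)

  hasAbs-split : ∀ N v → distinctAbs v ≡ true → 𝟙 (hasAbs (suc N) v) ≡ 𝟙 (occurs -[1+ N ] v) + 𝟙 (occurs (ℤ.+ suc N) v)
  hasAbs-split N []      _        = refl
  hasAbs-split N (y ∷ w) distinct with ∣ y ∣ ℕ.≟ suc N
  ... | no ∣y∣≢ rewrite ⌊⌋-false (-[1+ N ] ℤ.≟ y) (λ { refl → ∣y∣≢ refl })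
                      | ⌊⌋-false (ℤ.+ suc N ℤ.≟ y) (λ { refl → ∣y∣≢ refl }) = hasAbs-split N w (∧-conicalʳ _ _ distinct)
  ... | yes ∣y∣≡ = by-sign y ∣y∣≡ (subst (λ a → not (hasAbs a w) ≡ true) ∣y∣≡ (∧-conicalˡ _ _ distinct))
    where
    avoids : ∀ t → ∣ t ∣ ≡ suc N → not (hasAbs (suc N) w) ≡ true → occurs t w ≡ false
    avoids t ∣t∣≡ fresh = AvoidsAbs⇒¬occurs t w (subst (λ a → AvoidsAbs a w) (sym ∣t∣≡)
      (hasAbs≡false⇒AvoidsAbs (suc N) w (not-injective fresh)))
    by-sign : ∀ y → ∣ y ∣ ≡ suc N → not (hasAbs (suc N) w) ≡ true →
      1 ≡ 𝟙 (⌊ -[1+ N ] ℤ.≟ y ⌋ ∨ occurs -[1+ N ] w) + 𝟙 (⌊ ℤ.+ suc N ℤ.≟ y ⌋ ∨ occurs (ℤ.+ suc N) w)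
    by-sign -[1+ .N ] refl fresh rewrite ⌊⌋-true (-[1+ N ] ℤ.≟ -[1+ N ]) refl | ⌊⌋-false (ℤ.+ suc N ℤ.≟ -[1+ N ]) (λ ())
      | avoids (ℤ.+ suc N) refl fresh = refl
    by-sign (ℤ.+ .(suc N)) refl fresh rewrite ⌊⌋-true (ℤ.+ suc N ℤ.≟ ℤ.+ suc N) refl | ⌊⌋-false (-[1+ N ] ℤ.≟ ℤ.+ suc N) (λ ())
      | avoids -[1+ N ] refl fresh = refl

  ascending⇒head< : ∀ x w → ascending (x ∷ w) ≡ true → All (x ℤ.<_) w
  ascending⇒head< x []      _   = []
  ascending⇒head< x (y ∷ w) asc = x<y ∷ All.map (ℤ.<-trans x<y) (ascending⇒head< y w (∧-conicalʳ _ _ asc))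
    where
    x<y : x ℤ.< y
    x<y = ⌊⌋≡true⇒ (x ℤ.<? y) (∧-conicalˡ _ _ asc)

  ascending⇒<last : ∀ u y → ascending (u ∷ʳ y) ≡ true → All (ℤ._< y) u
  ascending⇒<last []          y _   = []
  ascending⇒<last (a ∷ [])    y asc = ⌊⌋≡true⇒ (a ℤ.<? y) (∧-conicalˡ _ _ asc) ∷ []
  ascending⇒<last (a ∷ b ∷ r) y asc with ascending⇒<last (b ∷ r) y (∧-conicalʳ _ _ asc)
  ... | b<y ∷ r<y = ℤ.<-trans (⌊⌋≡true⇒ (a ℤ.<? b) (∧-conicalˡ _ _ asc)) b<y ∷ b<y ∷ r<y

  ascending-∷-min : ∀ t w → All (t ℤ.<_) w → ascending (t ∷ w) ≡ ascending w
  ascending-∷-min t []      _         = refl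
  ascending-∷-min t (y ∷ w) (t<y ∷ _) = cong (_∧ ascending (y ∷ w)) (⌊⌋-true (t ℤ.<? y) t<y)

  ascending-∷ʳ-max : ∀ u t → All (ℤ._< t) u → ascending (u ∷ʳ t) ≡ ascending u
  ascending-∷ʳ-max []          t _                 = refl
  ascending-∷ʳ-max (x ∷ [])    t (x<t ∷ [])        = trans (∧-identityʳ _) (⌊⌋-true (x ℤ.<? t) x<t)
  ascending-∷ʳ-max (x ∷ b ∷ r) t (_ ∷ b∷r<t)       = cong (⌊ x ℤ.<? b ⌋ ∧_) (ascending-∷ʳ-max (b ∷ r) t b∷r<t)

  Letter⇒≮-[1+N] : ∀ N x → Letter (suc N) x → ¬ (x ℤ.< -[1+ N ])
  Letter⇒≮-[1+N] N -[1+ b ] (_ , s≤s b≤N) (ℤ.-<- N<b) = <⇒≱ N<b b≤N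

  Letter⇒≯+[1+N] : ∀ N y → Letter (suc N) y → ¬ (ℤ.+ suc N ℤ.< y)
  Letter⇒≯+[1+N] N (ℤ.+ b) (_ , b≤1+N) (ℤ.+<+ 1+N<b) = <⇒≱ 1+N<b b≤1+N

  -[1+N]<Letter : ∀ N y → Letter (suc N) y → ∣ y ∣ ≢ suc N → -[1+ N ] ℤ.< y
  -[1+N]<Letter N (ℤ.+ b)  _            _       = ℤ.-<+
  -[1+N]<Letter N -[1+ b ] (_ , s≤s b≤N) ∣y∣≢1+N = ℤ.-<- (≤∧≢⇒< b≤N (∣y∣≢1+N ∘ cong suc))

  Letter<+[1+N] : ∀ N y → Letter (suc N) y → ∣ y ∣ ≢ suc N → y ℤ.< ℤ.+ suc N
  Letter<+[1+N] N (ℤ.+ b)  (_ , b≤1+N) ∣y∣≢1+N = ℤ.+<+ (s≤s (≤-pred (≤∧≢⇒< b≤1+N ∣y∣≢1+N)))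
  Letter<+[1+N] N -[1+ b ] _           _       = ℤ.-<+

  disjointAbs-[_] : ∀ t u → disjointAbs u (t ∷ []) ≡ not (hasAbs ∣ t ∣ u)
  disjointAbs-[ t ] []      = refl
  disjointAbs-[ t ] (x ∷ u) = trans
    (cong₂ (λ e d → not e ∧ d) (trans (∨-identityʳ _) (⌊⌋-⇔ (mk⇔ sym sym) (∣ t ∣ ℕ.≟ ∣ x ∣) (∣ x ∣ ℕ.≟ ∣ t ∣))) (disjointAbs-[ t ] u))
    (sym (not-∨ ⌊ ∣ x ∣ ℕ.≟ ∣ t ∣ ⌋ (hasAbs ∣ t ∣ u)))
    where
    not-∨ : ∀ a b → not (a ∨ b) ≡ not a ∧ not b
    not-∨ true  b = refl
    not-∨ false b = refl

  -- An ascending word can contain -(N + 1) only as its first letter and N + 1 only as its last.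
  module AscendingRecurrence (N : ℕ) where

    private
      L : List ℤ
      L = signedLetters (suc N)
      X : List ℤ → ℕ
      X v = 𝟙 (distinctAbs v ∧ ascending v)
      t⁻ t⁺ : ℤ
      t⁻ = -[1+ N ]
      t⁺ = ℤ.+ suc N
      t⁻-letter : Letter (suc N) t⁻
      t⁻-letter = s≤s z≤n , ≤-refl
      t⁺-letter : Letter (suc N) t⁺
      t⁺-letter = s≤s z≤n , ≤-refl

      ∑-avoiding-top : ∀ j → ∑ (words j L) (λ w → 𝟙 (not (hasAbs (suc N) w)) * X w) ≡ count ascending j N
      ∑-avoiding-top j = trans (∑-words-avoiding j N N ≤-refl X)
        (∑-cong (words j (signedLetters N)) (λ w → cong₂ (λ d a → 𝟙 (d ∧ a)) (distinctAbs-skipAbs N w) (ascending-skipInvariant N w)))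

      X-∷-min : ∀ w → All (Letter (suc N)) w → X (t⁻ ∷ w) ≡ 𝟙 (not (hasAbs (suc N) w)) * X w
      X-∷-min w w-letters = 𝟙-guard (not (hasAbs (suc N) w)) (distinctAbs w) (ascending (t⁻ ∷ w)) (ascending w)
        (λ fresh → ascending-∷-min t⁻ w (All.zipWith (λ {y} (ℓ , a) → -[1+N]<Letter N y ℓ a)
          (w-letters , hasAbs≡false⇒AvoidsAbs (suc N) w (not-injective fresh))))

      X-∷ʳ-max : ∀ u → All (Letter (suc N)) u → X (u ∷ʳ t⁺) ≡ 𝟙 (not (hasAbs (suc N) u)) * X u
      X-∷ʳ-max u u-letters = trans
        (cong (λ d → 𝟙 (d ∧ ascending (u ∷ʳ t⁺))) (trans (distinctAbs-++ u (t⁺ ∷ []))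
          (trans (cong (λ e → distinctAbs u ∧ (e ∧ true)) (disjointAbs-[ t⁺ ] u))
            (trans (cong (distinctAbs u ∧_) (∧-identityʳ _)) (∧-comm (distinctAbs u) _)))))
        (𝟙-guard (not (hasAbs (suc N) u)) (distinctAbs u) (ascending (u ∷ʳ t⁺)) (ascending u)
          (λ fresh → ascending-∷ʳ-max u t⁺ (All.zipWith (λ {y} (ℓ , a) → Letter<+[1+N] N y ℓ a)
            (u-letters , hasAbs≡false⇒AvoidsAbs (suc N) u (not-injective fresh)))))

      occurs-head : ∀ x w → Letter (suc N) x → 𝟙 (occurs t⁻ (x ∷ w)) * X (x ∷ w) ≡ 𝟙 ⌊ t⁻ ℤ.≟ x ⌋ * X (x ∷ w)
      occurs-head x w x-letter = 𝟙-∨-redundant ⌊ t⁻ ℤ.≟ x ⌋ (occurs t⁻ w) (X (x ∷ w))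
        (𝟙-exclusive (occurs t⁻ w) (distinctAbs (x ∷ w)) (ascending (x ∷ w)) (λ o → ¬-not (λ asc →
          Letter⇒≮-[1+N] N x x-letter (occurs⇒All t⁻ w o (ascending⇒head< x w asc)))))

      occurs-last : ∀ u y → Letter (suc N) y → 𝟙 (occurs t⁺ (u ∷ʳ y)) * X (u ∷ʳ y) + 0 ≡ 𝟙 ⌊ t⁺ ℤ.≟ y ⌋ * X (u ∷ʳ y)
      occurs-last u y y-letter = begin
          𝟙 (occurs t⁺ (u ∷ʳ y)) * X (u ∷ʳ y) + 0
            ≡⟨ trans (+-identityʳ _) (cong (λ b → 𝟙 b * X (u ∷ʳ y)) (any-++ (λ z → ⌊ t⁺ ℤ.≟ z ⌋) u (y ∷ []))) ⟩
          𝟙 (occurs t⁺ u ∨ (⌊ t⁺ ℤ.≟ y ⌋ ∨ false)) * X (u ∷ʳ y)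
            ≡⟨ cong (λ b → 𝟙 (occurs t⁺ u ∨ b) * X (u ∷ʳ y)) (∨-identityʳ _) ⟩
          𝟙 (occurs t⁺ u ∨ ⌊ t⁺ ℤ.≟ y ⌋) * X (u ∷ʳ y)
            ≡⟨ cong (λ b → 𝟙 b * X (u ∷ʳ y)) (∨-comm (occurs t⁺ u) _) ⟩
          𝟙 (⌊ t⁺ ℤ.≟ y ⌋ ∨ occurs t⁺ u) * X (u ∷ʳ y)
            ≡⟨ 𝟙-∨-redundant ⌊ t⁺ ℤ.≟ y ⌋ (occurs t⁺ u) (X (u ∷ʳ y))
                 (𝟙-exclusive (occurs t⁺ u) (distinctAbs (u ∷ʳ y)) (ascending (u ∷ʳ y)) (λ o → ¬-not (λ asc →
                   Letter⇒≯+[1+N] N y y-letter (occurs⇒All t⁺ u o (ascending⇒<last u y asc))))) ⟩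
          𝟙 ⌊ t⁺ ℤ.≟ y ⌋ * X (u ∷ʳ y) ∎
        where open ≡-Reasoning

      ∑-occurs-bottom : ∀ k → ∑ (words (suc k) L) (λ v → 𝟙 (occurs t⁻ v) * X v) ≡ count ascending k N
      ∑-occurs-bottom k = begin
          ∑ (words (suc k) L) (λ v → 𝟙 (occurs t⁻ v) * X v)
            ≡⟨ ∑-words-suc k L _ ⟩
          ∑ L (λ x → ∑ (words k L) (λ w → 𝟙 (occurs t⁻ (x ∷ w)) * X (x ∷ w)))
            ≡⟨ ∑-cong-All (signedLetters-Letter (suc N)) (λ x ℓ → ∑-cong (words k L) (λ w → occurs-head x w ℓ)) ⟩
          ∑ L (λ x → ∑ (words k L) (λ w → 𝟙 ⌊ t⁻ ℤ.≟ x ⌋ * X (x ∷ w)))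
            ≡⟨ ∑-cong L (λ x → ∑-*ˡ (words k L) (𝟙 ⌊ t⁻ ℤ.≟ x ⌋) (λ w → X (x ∷ w))) ⟩
          ∑ L (λ x → 𝟙 ⌊ t⁻ ℤ.≟ x ⌋ * ∑ (words k L) (λ w → X (x ∷ w)))
            ≡⟨ ∑-signedLetters-indicator (suc N) t⁻ t⁻-letter (λ x → ∑ (words k L) (λ w → X (x ∷ w))) ⟩
          ∑ (words k L) (λ w → X (t⁻ ∷ w))
            ≡⟨ ∑-words-cong k (signedLetters-Letter (suc N)) (λ w _ ℓ → X-∷-min w ℓ) ⟩
          ∑ (words k L) (λ w → 𝟙 (not (hasAbs (suc N) w)) * X w)
            ≡⟨ ∑-avoiding-top k ⟩
          count ascending k N ∎
        where open ≡-Reasoning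

      ∑-occurs-top : ∀ k → ∑ (words (suc k) L) (λ v → 𝟙 (occurs t⁺ v) * X v) ≡ count ascending k N
      ∑-occurs-top k = begin
          ∑ (words (suc k) L) F
            ≡⟨ cong (λ l → ∑ (words l L) F) (+-comm 1 k) ⟩
          ∑ (words (k + 1) L) F
            ≡⟨ ∑-words-+ k 1 L F ⟩
          ∑ (words k L) (λ u → ∑ (words 1 L) (λ v → F (u ++ v)))
            ≡⟨ ∑-cong (words k L) (λ u → ∑-words-suc 0 L (λ v → F (u ++ v))) ⟩
          ∑ (words k L) (λ u → ∑ L (λ y → F (u ∷ʳ y) + 0))
            ≡⟨ ∑-cong (words k L) (λ u → ∑-cong-All (signedLetters-Letter (suc N)) (λ y ℓ → occurs-last u y ℓ)) ⟩
          ∑ (words k L) (λ u → ∑ L (λ y → 𝟙 ⌊ t⁺ ℤ.≟ y ⌋ * X (u ∷ʳ y)))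
            ≡⟨ ∑-cong (words k L) (λ u → ∑-signedLetters-indicator (suc N) t⁺ t⁺-letter (λ y → X (u ∷ʳ y))) ⟩
          ∑ (words k L) (λ u → X (u ∷ʳ t⁺))
            ≡⟨ ∑-words-cong k (signedLetters-Letter (suc N)) (λ u _ ℓ → X-∷ʳ-max u ℓ) ⟩
          ∑ (words k L) (λ u → 𝟙 (not (hasAbs (suc N) u)) * X u)
            ≡⟨ ∑-avoiding-top k ⟩
          count ascending k N ∎
        where
        open ≡-Reasoning
        F : List ℤ → ℕ
        F v = 𝟙 (occurs t⁺ v) * X v

    count-ascending-suc : ∀ k → count ascending (suc k) (suc N) ≡ count ascending (suc k) N + 2 * count ascending k N
    count-ascending-suc k = begin
        ∑ W X
          ≡⟨ ∑-cong W (λ v → split (hasAbs (suc N) v) (X v)) ⟨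
        ∑ W (λ v → 𝟙 (not (hasAbs (suc N) v)) * X v + 𝟙 (hasAbs (suc N) v) * X v)
          ≡⟨ ∑-+ W _ _ ⟩
        ∑ W (λ v → 𝟙 (not (hasAbs (suc N) v)) * X v) + ∑ W (λ v → 𝟙 (hasAbs (suc N) v) * X v)
          ≡⟨ cong₂ _+_ (∑-avoiding-top (suc k)) (∑-cong W by-sign) ⟩
        count ascending (suc k) N + ∑ W (λ v → 𝟙 (occurs t⁻ v) * X v + 𝟙 (occurs t⁺ v) * X v)
          ≡⟨ cong (count ascending (suc k) N +_) (trans (∑-+ W _ _) (cong₂ _+_ (∑-occurs-bottom k) (∑-occurs-top k))) ⟩
        count ascending (suc k) N + (count ascending k N + count ascending k N)
          ≡⟨ cong (λ c → count ascending (suc k) N + (count ascending k N + c)) (+-identityʳ _) ⟨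
        count ascending (suc k) N + 2 * count ascending k N ∎
      where
      open ≡-Reasoning
      W : List (List ℤ)
      W = words (suc k) L
      split : ∀ b x → 𝟙 (not b) * x + 𝟙 b * x ≡ x
      split true  x = +-identityʳ x
      split false x = trans (+-identityʳ (x + 0)) (+-identityʳ x)
      by-sign : ∀ v → 𝟙 (hasAbs (suc N) v) * X v ≡ 𝟙 (occurs t⁻ v) * X v + 𝟙 (occurs t⁺ v) * X v
      by-sign v with distinctAbs v in distinct
      ... | true  = trans (cong (_* 𝟙 (ascending v)) (hasAbs-split N v distinct)) (*-distribʳ-+ (𝟙 (ascending v)) (𝟙 (occurs t⁻ v)) _)
      ... | false = trans (*-zeroʳ (𝟙 (hasAbs (suc N) v))) (sym (cong₂ _+_ (*-zeroʳ (𝟙 (occurs t⁻ v))) (*-zeroʳ (𝟙 (occurs t⁺ v)))))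

  count-ascending : ∀ k → count ascending k k ≡ 2 ^ k
  count-ascending zero    = refl
  count-ascending (suc k) = trans (AscendingRecurrence.count-ascending-suc k k)
    (cong₂ (λ a b → a + 2 * b) (count-length>alphabet ascending k) (count-ascending k))

  descending-neg : ∀ v → descending (map -_ v) ≡ ascending v
  descending-neg []          = refl
  descending-neg (a ∷ [])    = refl
  descending-neg (a ∷ b ∷ r) = cong₂ _∧_ (⌊⌋-⇔ (mk⇔ ℤ.neg-cancel-< ℤ.neg-mono-<) _ _) (descending-neg (b ∷ r))

  distinctAbs-neg : ∀ v → distinctAbs (map -_ v) ≡ distinctAbs v
  distinctAbs-neg []      = refl
  distinctAbs-neg (x ∷ w) = cong₂ (λ h d → not h ∧ d)
    (trans (cong (λ a → hasAbs a (map -_ w)) (ℤ.∣-i∣≡∣i∣ x))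
      (hasAbs-map -_ ∣ x ∣ ∣ x ∣ (λ y _ → subst (λ a → a ≡ ∣ x ∣ ⇔ ∣ y ∣ ≡ ∣ x ∣) (sym (ℤ.∣-i∣≡∣i∣ y)) (mk⇔ id id))
        (All.universal (λ _ → tt) w)))
    (distinctAbs-neg w)

  count-descending : ∀ k → count descending k k ≡ 2 ^ k
  count-descending k = trans count-descending≡count-ascending (count-ascending k)
    where
    neg : ℕ → ℤ
    neg a = - (ℤ.+ a)
    R : List ℕ
    R = range 1 k
    neg-signedLetters : map -_ (signedLetters k) ≡ map ℤ.+_ R ++ map neg R
    neg-signedLetters = trans (map-++ -_ (map neg R) (map ℤ.+_ R))
      (cong₂ _++_ (trans (sym (map-∘ R)) (map-cong (λ a → ℤ.neg-involutive (ℤ.+ a)) R)) (sym (map-∘ R)))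
    F : List ℤ → ℕ
    F v = 𝟙 (distinctAbs v ∧ descending v)
    count-descending≡count-ascending : count descending k k ≡ count ascending k k
    count-descending≡count-ascending = begin
        ∑ (words k (map neg R ++ map ℤ.+_ R)) F
          ≡⟨ ∑-words-++-comm k (map neg R) (map ℤ.+_ R) F ⟩
        ∑ (words k (map ℤ.+_ R ++ map neg R)) F
          ≡⟨ cong (λ xs → ∑ (words k xs) F) neg-signedLetters ⟨
        ∑ (words k (map -_ (signedLetters k))) F
          ≡⟨ ∑-words-map k -_ (signedLetters k) F ⟩
        ∑ (words k (signedLetters k)) (F ∘ map -_)
          ≡⟨ ∑-cong (words k _) (λ v → cong₂ (λ d a → 𝟙 (d ∧ a)) (distinctAbs-neg v) (descending-neg v)) ⟩
        count ascending k k ∎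
      where open ≡-Reasoning

  cut : List ℤ → ℕ → Bool
  cut z p = descending (take p z) ∧ ascending (drop p z)

  #cuts : List ℤ → ℕ
  #cuts z = ∑ (range 0 (suc (length z))) (λ p → 𝟙 (cut z p))

  distinctAbs⇒Linked≢ : ∀ z → distinctAbs z ≡ true → Linked _≢_ z
  distinctAbs⇒Linked≢ []          _        = []
  distinctAbs⇒Linked≢ (x ∷ [])    _        = [-]
  distinctAbs⇒Linked≢ (x ∷ y ∷ r) distinct = x≢y ∷ distinctAbs⇒Linked≢ (y ∷ r) (∧-conicalʳ (not (hasAbs ∣ x ∣ (y ∷ r))) _ distinct)
    where
    x≢y : x ≢ y
    x≢y refl with () ← trans (cong (λ b → not (b ∨ hasAbs ∣ x ∣ r)) (sym (⌊⌋-true (∣ x ∣ ℕ.≟ ∣ x ∣) refl)))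
                              (∧-conicalˡ (not (hasAbs ∣ x ∣ (x ∷ r))) _ distinct)

  peakFree-ascent : ∀ x y r → x ℤ.< y → Linked _≢_ (y ∷ r) → peakFree (x ∷ y ∷ r) ≡ ascending (y ∷ r)
  peakFree-ascent x y []      x<y _ = refl
  peakFree-ascent x y (c ∷ r) x<y (y≢c ∷ adjacent) with ℤ.<-cmp y c
  ... | tri< y<c _ _ rewrite ⌊⌋-true (x ℤ.<? y) x<y | ⌊⌋-false (c ℤ.<? y) (ℤ.<-asym y<c) | ⌊⌋-true (y ℤ.<? c) y<c =
    peakFree-ascent y c r y<c adjacent
  ... | tri≈ _ y≡c _ = ⊥-elim (y≢c y≡c)
  ... | tri> _ _ c<y rewrite ⌊⌋-true (x ℤ.<? y) x<y | ⌊⌋-true (c ℤ.<? y) c<y | ⌊⌋-false (y ℤ.<? c) (ℤ.<-asym c<y) = refl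

  peakFree-descent : ∀ x y r → ¬ (x ℤ.< y) → peakFree (x ∷ y ∷ r) ≡ peakFree (y ∷ r)
  peakFree-descent x y []      _   = refl
  peakFree-descent x y (c ∷ r) x≮y rewrite ⌊⌋-false (x ℤ.<? y) x≮y = refl

  -- A peak-free word descends to its minimum and then ascends; the minimum may go on either side of the cut.
  #cuts≡2*peakFree : ∀ z → Linked _≢_ z → 1 ≤ length z → #cuts z ≡ 2 * 𝟙 (peakFree z)
  #cuts≡2*peakFree (x ∷ [])    _                  _ = refl
  #cuts≡2*peakFree (x ∷ y ∷ r) (x≢y ∷ adjacent) _ with ℤ.<-cmp x y
  ... | tri≈ _ x≡y _ = ⊥-elim (x≢y x≡y)
  ... | tri< x<y _ _ = begin
      #cuts (x ∷ y ∷ r)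
        ≡⟨ cong₂ _+_ (cong (λ b → 𝟙 (b ∧ ascending (y ∷ r))) (⌊⌋-true (x ℤ.<? y) x<y))
             (trans (∑-range-suc 0 (suc (suc (length r))) (𝟙 ∘ cut (x ∷ y ∷ r)))
               (cong (𝟙 (ascending (y ∷ r)) +_) (trans (∑-range-suc 0 (suc (length r)) _)
                 (∑-zero (range 0 (suc (length r))) (λ p → cong (λ b → 𝟙 ((b ∧ descending (y ∷ take p r)) ∧ ascending (drop p r)))
                   (⌊⌋-false (y ℤ.<? x) (ℤ.<-asym x<y))))))) ⟩
      𝟙 (ascending (y ∷ r)) + (𝟙 (ascending (y ∷ r)) + 0)
        ≡⟨ cong (λ b → 𝟙 b + (𝟙 b + 0)) (peakFree-ascent x y r x<y adjacent) ⟨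
      2 * 𝟙 (peakFree (x ∷ y ∷ r)) ∎
    where open ≡-Reasoning
  ... | tri> _ _ y<x = begin
      #cuts (x ∷ y ∷ r)
        ≡⟨ cong₂ _+_ (cong (λ b → 𝟙 (b ∧ ascending (y ∷ r))) (⌊⌋-false (x ℤ.<? y) (ℤ.<-asym y<x)))
             (∑-range-suc 0 (suc (suc (length r))) (𝟙 ∘ cut (x ∷ y ∷ r))) ⟩
      ∑ (range 0 (suc (suc (length r)))) (λ p → 𝟙 (cut (x ∷ y ∷ r) (suc p)))
        ≡⟨ ∑-cong (range 0 (suc (suc (length r)))) shift ⟩
      #cuts (y ∷ r)
        ≡⟨ #cuts≡2*peakFree (y ∷ r) adjacent (s≤s z≤n) ⟩
      2 * 𝟙 (peakFree (y ∷ r))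
        ≡⟨ cong (λ b → 2 * 𝟙 b) (peakFree-descent x y r (ℤ.<-asym y<x)) ⟨
      2 * 𝟙 (peakFree (x ∷ y ∷ r)) ∎
    where
    open ≡-Reasoning
    shift : ∀ p → 𝟙 (cut (x ∷ y ∷ r) (suc p)) ≡ 𝟙 (cut (y ∷ r) p)
    shift zero    = refl
    shift (suc p) = cong (λ b → 𝟙 ((b ∧ descending (y ∷ take p r)) ∧ ascending (drop p r))) (⌊⌋-true (y ℤ.<? x) y<x)

  ∑-binomial : ∀ k l → k < l → ∑ (range 0 l) (k C_) ≡ 2 ^ k
  ∑-binomial zero    (suc l) _         = cong suc (trans (∑-range-suc 0 l (0 C_)) (∑-zero (range 0 l) (λ _ → refl)))
  ∑-binomial (suc k) (suc l) (s<s k<l) = begin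
      1 + ∑ (range 1 l) (suc k C_)
        ≡⟨ cong (1 +_) (∑-range-suc 0 l (suc k C_)) ⟩
      1 + ∑ (range 0 l) (λ p → suc k C suc p)
        ≡⟨ cong (1 +_) (∑-cong (range 0 l) (λ p → sym (nCk+nC[k+1]≡[n+1]C[k+1] k p))) ⟩
      1 + ∑ (range 0 l) (λ p → k C p + k C suc p)
        ≡⟨ cong (1 +_) (∑-+ (range 0 l) (k C_) (λ p → k C suc p)) ⟩
      1 + (∑ (range 0 l) (k C_) + ∑ (range 0 l) (λ p → k C suc p))
        ≡⟨ +-suc (∑ (range 0 l) (k C_)) _ ⟨
      ∑ (range 0 l) (k C_) + (1 + ∑ (range 0 l) (λ p → k C suc p))
        ≡⟨ cong (λ s → ∑ (range 0 l) (k C_) + (1 + s)) (∑-range-suc 0 l (k C_)) ⟨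
      ∑ (range 0 l) (k C_) + ∑ (range 0 (suc l)) (k C_)
        ≡⟨ cong₂ _+_ (∑-binomial k l k<l) (∑-binomial k (suc l) (m<n⇒m<1+n k<l)) ⟩
      2 ^ k + 2 ^ k
        ≡⟨ cong (2 ^ k +_) (+-identityʳ (2 ^ k)) ⟨
      2 ^ suc k ∎
    where open ≡-Reasoning

  ∑-distinct-cut : ∀ k p → p ≤ k → ∑ (words k (signedLetters k)) (λ z → 𝟙 (distinctAbs z) * 𝟙 (cut z p)) ≡ (k C p) * 2 ^ k
  ∑-distinct-cut k p p≤k = begin
      ∑ (words k L) F
        ≡⟨ cong (λ l → ∑ (words l L) F) (m+[n∸m]≡n p≤k) ⟨
      ∑ (words (p + (k ∸ p)) L) F
        ≡⟨ ∑-words-+ p (k ∸ p) L F ⟩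
      ∑ (words p L) (λ u → ∑ (words (k ∸ p) L) (λ v → F (u ++ v)))
        ≡⟨ ∑-words-cong p (signedLetters-Letter k) (λ u |u|≡p _ → ∑-cong (words (k ∸ p) L) (λ v → split u v |u|≡p)) ⟩
      ∑ (words p L) (λ u → ∑ (words (k ∸ p) L) (λ v → 𝟙 (distinctAbs (u ++ v) ∧ (descending u ∧ ascending v))))
        ≡⟨ count*count descending ascending-skipInvariant p (k ∸ p) k ⟩
      count descending p k * count ascending (k ∸ p) (k ∸ p)
        ≡⟨ cong₂ _*_ (count≡C*count descending-skipInvariant p k p≤k) (count-ascending (k ∸ p)) ⟩
      (k C p) * count descending p p * 2 ^ (k ∸ p)
        ≡⟨ cong (λ c → (k C p) * c * 2 ^ (k ∸ p)) (count-descending p) ⟩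
      (k C p) * 2 ^ p * 2 ^ (k ∸ p)
        ≡⟨ *-assoc (k C p) (2 ^ p) (2 ^ (k ∸ p)) ⟩
      (k C p) * (2 ^ p * 2 ^ (k ∸ p))
        ≡⟨ cong ((k C p) *_) (trans (sym (^-distribˡ-+-* 2 p (k ∸ p))) (cong (2 ^_) (m+[n∸m]≡n p≤k))) ⟩
      (k C p) * 2 ^ k ∎
    where
    open ≡-Reasoning
    L : List ℤ
    L = signedLetters k
    F : List ℤ → ℕ
    F z = 𝟙 (distinctAbs z) * 𝟙 (cut z p)
    split : ∀ u v → length u ≡ p → F (u ++ v) ≡ 𝟙 (distinctAbs (u ++ v) ∧ (descending u ∧ ascending v))
    split u v refl = trans (cong₂ (λ a b → 𝟙 (distinctAbs (u ++ v)) * 𝟙 (descending a ∧ ascending b)) (take-length-++ u v) (drop-length-++ u v))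
      (sym (𝟙-∧ (distinctAbs (u ++ v)) _))

  2*count-peakFree : ∀ k → 1 ≤ k → 2 * count peakFree k k ≡ 2 ^ k * 2 ^ k
  2*count-peakFree k 1≤k = begin
      2 * count peakFree k k
        ≡⟨ ∑-*ˡ (words k L) 2 _ ⟨
      ∑ (words k L) (λ z → 2 * 𝟙 (distinctAbs z ∧ peakFree z))
        ≡⟨ ∑-words-cong k (signedLetters-Letter k) (λ z |z|≡k _ → via-cuts z |z|≡k) ⟩
      ∑ (words k L) (λ z → ∑ (range 0 (suc k)) (λ p → 𝟙 (distinctAbs z) * 𝟙 (cut z p)))
        ≡⟨ ∑-comm (words k L) (range 0 (suc k)) (λ z p → 𝟙 (distinctAbs z) * 𝟙 (cut z p)) ⟩
      ∑ (range 0 (suc k)) (λ p → ∑ (words k L) (λ z → 𝟙 (distinctAbs z) * 𝟙 (cut z p)))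
        ≡⟨ ∑-cong-All (range-bounds 0 (suc k)) (λ p (_ , p<1+k) → ∑-distinct-cut k p (≤-pred p<1+k)) ⟩
      ∑ (range 0 (suc k)) (λ p → (k C p) * 2 ^ k)
        ≡⟨ ∑-*ʳ (range 0 (suc k)) (2 ^ k) (k C_) ⟩
      ∑ (range 0 (suc k)) (k C_) * 2 ^ k
        ≡⟨ cong (_* 2 ^ k) (∑-binomial k (suc k) ≤-refl) ⟩
      2 ^ k * 2 ^ k ∎
    where
    open ≡-Reasoning
    L : List ℤ
    L = signedLetters k
    via-cuts : ∀ z → length z ≡ k → 2 * 𝟙 (distinctAbs z ∧ peakFree z) ≡ ∑ (range 0 (suc k)) (λ p → 𝟙 (distinctAbs z) * 𝟙 (cut z p))
    via-cuts z refl with distinctAbs z in distinct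
    ... | true  = trans (sym (#cuts≡2*peakFree z (distinctAbs⇒Linked≢ z distinct) 1≤k))
                    (sym (∑-cong (range 0 (suc (length z))) (λ p → +-identityʳ _)))
    ... | false = sym (∑-zero (range 0 (suc (length z))) (λ _ → refl))

  count-peakFree : ∀ k → 1 ≤ k → count peakFree k k ≡ 2 ^ (2 * k ∸ 1)
  count-peakFree k 1≤k = *-cancelˡ-≡ _ _ 2 (begin
      2 * count peakFree k k   ≡⟨ 2*count-peakFree k 1≤k ⟩
      2 ^ k * 2 ^ k            ≡⟨ ^-distribˡ-+-* 2 k k ⟨
      2 ^ (k + k)              ≡⟨ cong (2 ^_) (trans (cong (k +_) (sym (+-identityʳ k))) (sym (m∸n+n≡m 1≤2k))) ⟩
      2 ^ (2 * k ∸ 1 + 1)      ≡⟨ cong (2 ^_) (+-comm (2 * k ∸ 1) 1) ⟩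
      2 * 2 ^ (2 * k ∸ 1)      ∎)
    where
    open ≡-Reasoning
    1≤2k : 1 ≤ 2 * k
    1≤2k = ≤-trans 1≤k (m≤m+n k (k + 0))

  -- Peak sets of concatenations

  peakAt : ℤ → ℤ → ℤ → ℕ → List ℕ
  peakAt a b c p = if isPeak a b c then p ∷ [] else []

  -- The peaks of u ++ v at the last letter of u or the first letter of v, indexed as in peaksFrom i.
  junctionPeaks : ℕ → List ℤ → List ℤ → List ℕ
  junctionPeaks i (y ∷ [])          (z ∷ z′ ∷ _) = peakAt y z z′ (suc i)
  junctionPeaks i (y ∷ y′ ∷ [])     (z ∷ z′ ∷ _) = peakAt y y′ z (suc i) ++ peakAt y′ z z′ (suc (suc i))
  junctionPeaks i (y ∷ y′ ∷ y″ ∷ u) v            = junctionPeaks (suc i) (y′ ∷ y″ ∷ u) v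
  junctionPeaks i _                 _            = []

  peaksFrom-++ : ∀ i y u z z′ r → peaksFrom i ((y ∷ u) ++ z ∷ z′ ∷ r) ≡
    peaksFrom i (y ∷ u) ++ (junctionPeaks i (y ∷ u) (z ∷ z′ ∷ r) ++ peaksFrom (length (y ∷ u) + i) (z ∷ z′ ∷ r))
  peaksFrom-++ i y [] z z′ r = sym (if-∷-++ (isPeak y z z′) (suc i) [] _)
  peaksFrom-++ i y (y′ ∷ []) z z′ r with isPeak y y′ z | isPeak y′ z z′
  ... | true  | true  = refl
  ... | true  | false = refl
  ... | false | true  = refl
  ... | false | false = refl
  peaksFrom-++ i y (y′ ∷ y″ ∷ u) z z′ r = trans
    (cong (λ P → if isPeak y y′ y″ then suc i ∷ P else P) (trans (peaksFrom-++ (suc i) y′ (y″ ∷ u) z z′ r)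
      (cong (λ l → peaksFrom (suc i) (y′ ∷ y″ ∷ u) ++ (junctionPeaks (suc i) (y′ ∷ y″ ∷ u) (z ∷ z′ ∷ r) ++ peaksFrom l (z ∷ z′ ∷ r)))
        (+-suc (length (y′ ∷ y″ ∷ u)) i))))
    (sym (if-∷-++ (isPeak y y′ y″) (suc i) _ _))

  peaksFrom-lower : ∀ i w → All (suc i ≤_) (peaksFrom i w)
  peaksFrom-lower i []              = []
  peaksFrom-lower i (a ∷ [])        = []
  peaksFrom-lower i (a ∷ b ∷ [])    = []
  peaksFrom-lower i (a ∷ b ∷ c ∷ r) = All-if (isPeak a b c) (suc i) _ ≤-refl
    (All.map (≤-trans (n≤1+n _)) (peaksFrom-lower (suc i) (b ∷ c ∷ r)))

  peaksFrom-upper : ∀ i w → All (λ p → suc (suc p) ≤ i + length w) (peaksFrom i w)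
  peaksFrom-upper i []              = []
  peaksFrom-upper i (a ∷ [])        = []
  peaksFrom-upper i (a ∷ b ∷ [])    = []
  peaksFrom-upper i (a ∷ b ∷ c ∷ r) = All-if (isPeak a b c) (suc i) _
    (subst (3 + i ≤_) (sym (+-suc i _)) (s≤s (subst (_≤ i + suc (suc (length r))) (+-comm i 2) (+-monoʳ-≤ i (s≤s (s≤s z≤n))))))
    (All.map (λ {p} → subst (suc (suc p) ≤_) (sym (+-suc i _))) (peaksFrom-upper (suc i) (b ∷ c ∷ r)))

  Separated : ℕ → ℕ → Set
  Separated a b = suc a < b

  peaksFrom-separated : ∀ i w → Linked Separated (peaksFrom i w)
  peaksFrom-separated i []                  = []
  peaksFrom-separated i (a ∷ [])            = []
  peaksFrom-separated i (a ∷ b ∷ [])        = []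
  peaksFrom-separated i (a ∷ b ∷ c ∷ [])    with isPeak a b c
  ... | true  = [-]
  ... | false = []
  peaksFrom-separated i (a ∷ b ∷ c ∷ d ∷ r) =
    step (peaksFrom-separated (suc i) (b ∷ c ∷ d ∷ r)) (peaksFrom-separated (suc (suc i)) (c ∷ d ∷ r))
    where
    prepend : ∀ {ps} → All (3 + i ≤_) ps → Linked Separated ps → Linked Separated (suc i ∷ ps)
    prepend []          _  = [-]
    prepend (3+i≤p ∷ _) ps = 3+i≤p ∷ ps
    step : Linked Separated (peaksFrom (suc i) (b ∷ c ∷ d ∷ r)) → Linked Separated (peaksFrom (suc (suc i)) (c ∷ d ∷ r)) →
      Linked Separated (peaksFrom i (a ∷ b ∷ c ∷ d ∷ r))
    step from-b from-c with isPeak a b c in peak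
    ... | false = from-b
    ... | true rewrite ⌊⌋-false (b ℤ.<? c) (ℤ.<-asym (⌊⌋≡true⇒ (c ℤ.<? b) (∧-conicalʳ _ _ peak))) =
      prepend (peaksFrom-lower (suc (suc i)) (c ∷ d ∷ r)) from-c

  data JunctionShape (j : ℕ) : List ℕ → Set where
    no-peak   : JunctionShape j []
    peak-at   : JunctionShape j (j ∷ [])
    peak-next : JunctionShape j (suc j ∷ [])

  JunctionShape⇒All≥ : ∀ {j J} → JunctionShape j J → All (j ≤_) J
  JunctionShape⇒All≥ no-peak   = []
  JunctionShape⇒All≥ peak-at   = ≤-refl ∷ []
  JunctionShape⇒All≥ peak-next = n≤1+n _ ∷ []

  junctionPeaks-shape : ∀ i y u z z′ r → JunctionShape (length u + i) (junctionPeaks i (y ∷ u) (z ∷ z′ ∷ r))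
  junctionPeaks-shape i y [] z z′ r with isPeak y z z′
  ... | true  = peak-next
  ... | false = no-peak
  junctionPeaks-shape i y (y′ ∷ []) z z′ r with isPeak y y′ z in peak
  ... | true rewrite ⌊⌋-false (y′ ℤ.<? z) (ℤ.<-asym (⌊⌋≡true⇒ (z ℤ.<? y′) (∧-conicalʳ _ _ peak))) = peak-at
  ... | false with isPeak y′ z z′
  ...   | true  = peak-next
  ...   | false = no-peak
  junctionPeaks-shape i y (y′ ∷ y″ ∷ u) z z′ r =
    subst (λ j → JunctionShape j (junctionPeaks (suc i) (y′ ∷ y″ ∷ u) (z ∷ z′ ∷ r))) (+-suc (length (y″ ∷ u)) i) (junctionPeaks-shape (suc i) y′ (y″ ∷ u) z z′ r)

  infix 4 _==_
  _==_ : List ℕ → List ℕ → Bool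
  P == Q = ⌊ ≡-dec ℕ._≟_ P Q ⌋

  peaksFrom≡[]⇒peakFree : ∀ i v → peaksFrom i v ≡ [] → peakFree v ≡ true
  peaksFrom≡[]⇒peakFree i []              _ = refl
  peaksFrom≡[]⇒peakFree i (a ∷ [])        _ = refl
  peaksFrom≡[]⇒peakFree i (a ∷ b ∷ [])    _ = refl
  peaksFrom≡[]⇒peakFree i (a ∷ b ∷ c ∷ r) = step (isPeak a b c) (peaksFrom≡[]⇒peakFree (suc i) (b ∷ c ∷ r))
    where
    step : ∀ p → (peaksFrom (suc i) (b ∷ c ∷ r) ≡ [] → peakFree (b ∷ c ∷ r) ≡ true) →
      (if p then suc i ∷ peaksFrom (suc i) (b ∷ c ∷ r) else peaksFrom (suc i) (b ∷ c ∷ r)) ≡ [] →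
      not p ∧ peakFree (b ∷ c ∷ r) ≡ true
    step false ih = ih

  peakFree⇒peaksFrom≡[] : ∀ i v → peakFree v ≡ true → peaksFrom i v ≡ []
  peakFree⇒peaksFrom≡[] i []              _ = refl
  peakFree⇒peaksFrom≡[] i (a ∷ [])        _ = refl
  peakFree⇒peaksFrom≡[] i (a ∷ b ∷ [])    _ = refl
  peakFree⇒peaksFrom≡[] i (a ∷ b ∷ c ∷ r) = step (isPeak a b c) (peakFree⇒peaksFrom≡[] (suc i) (b ∷ c ∷ r))
    where
    step : ∀ p → (peakFree (b ∷ c ∷ r) ≡ true → peaksFrom (suc i) (b ∷ c ∷ r) ≡ []) →
      not p ∧ peakFree (b ∷ c ∷ r) ≡ true →
      (if p then suc i ∷ peaksFrom (suc i) (b ∷ c ∷ r) else peaksFrom (suc i) (b ∷ c ∷ r)) ≡ []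
    step false ih = ih

  peaksFrom==[] : ∀ i v → (peaksFrom i v == []) ≡ peakFree v
  peaksFrom==[] i v = ⇔→≡ (mk⇔ (peaksFrom≡[]⇒peakFree i v ∘ ⌊⌋≡true⇒ (≡-dec ℕ._≟_ _ _))
    (⌊⌋-true (≡-dec ℕ._≟_ _ _) ∘ peakFree⇒peaksFrom≡[] i v))

  ++-≡-split : ∀ j (P S X Y : List ℕ) → All (_< j) P → All (_< j) S → All (j ≤_) X → All (j ≤_) Y →
    P ++ X ≡ S ++ Y → P ≡ S × X ≡ Y
  ++-≡-split j []      []      X       Y       _           _           _          _          e = refl , e
  ++-≡-split j []      (s ∷ S) (x ∷ X) Y       _           (s<j ∷ _)  (j≤x ∷ _) _          e =
    ⊥-elim (<⇒≱ s<j (subst (j ≤_) (∷-injectiveˡ e) j≤x))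
  ++-≡-split j (p ∷ P) []      X       (y ∷ Y) (p<j ∷ _)  _           _          (j≤y ∷ _) e =
    ⊥-elim (<⇒≱ p<j (subst (j ≤_) (sym (∷-injectiveˡ e)) j≤y))
  ++-≡-split j (p ∷ P) (s ∷ S) X       Y       (_ ∷ P<j)  (_ ∷ S<j)  j≤X        j≤Y        e
    with refl , e′ ← ∷-injective e with refl , X≡Y ← ++-≡-split j P S X Y P<j S<j j≤X j≤Y e′ = refl , X≡Y

  ==-++ : ∀ j (P S X Y : List ℕ) → All (_< j) P → All (_< j) S → All (j ≤_) X → All (j ≤_) Y →
    (P ++ X == S ++ Y) ≡ (P == S) ∧ (X == Y)
  ==-++ j P S X Y P<j S<j j≤X j≤Y with ≡-dec ℕ._≟_ P S | ≡-dec ℕ._≟_ X Y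
  ... | yes refl | yes refl = ⌊⌋-true (≡-dec ℕ._≟_ _ _) refl
  ... | yes _    | no X≢Y   = ⌊⌋-false (≡-dec ℕ._≟_ _ _) (X≢Y ∘ proj₂ ∘ ++-≡-split j P S X Y P<j S<j j≤X j≤Y)
  ... | no P≢S   | _        = ⌊⌋-false (≡-dec ℕ._≟_ _ _) (P≢S ∘ proj₁ ∘ ++-≡-split j P S X Y P<j S<j j≤X j≤Y)

  ++-∷≢[_] : ∀ t (J : List ℕ) {b B} → t < b → J ++ b ∷ B ≢ t ∷ []
  ++-∷≢[ t ] []          t<b e = <-irrefl (sym (∷-injectiveˡ e)) t<b
  ++-∷≢[ t ] (_ ∷ [])    t<b ()
  ++-∷≢[ t ] (_ ∷ _ ∷ _) t<b ()

  junction-cases : ∀ j {J} → JunctionShape j J → ∀ B → All (suc (suc j) ≤_) B →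
    𝟙 (J ++ B == suc j ∷ []) + 𝟙 (J ++ B == []) + 𝟙 (J ++ B == j ∷ []) ≡ 𝟙 (B == [])
  junction-cases j no-peak []        _ = refl
  junction-cases j peak-at []        _
    rewrite ⌊⌋-false (≡-dec ℕ._≟_ (j ∷ []) (suc j ∷ [])) (<⇒≢ (n<1+n j) ∘ ∷-injectiveˡ) | ⌊⌋-true (≡-dec ℕ._≟_ (j ∷ []) (j ∷ [])) refl = refl
  junction-cases j peak-next []      _
    rewrite ⌊⌋-true (≡-dec ℕ._≟_ (suc j ∷ []) (suc j ∷ [])) refl | ⌊⌋-false (≡-dec ℕ._≟_ (suc j ∷ []) (j ∷ [])) (<⇒≢ (n<1+n j) ∘ sym ∘ ∷-injectiveˡ) = refl
  junction-cases j {J} shape (b ∷ B) (2+j≤b ∷ _)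
    rewrite ⌊⌋-false (≡-dec ℕ._≟_ (J ++ b ∷ B) (suc j ∷ [])) (++-∷≢[ suc j ] J 2+j≤b)
          | ⌊⌋-false (≡-dec ℕ._≟_ (J ++ b ∷ B) []) ((λ ()) ∘ ++-conicalʳ J (b ∷ B))
          | ⌊⌋-false (≡-dec ℕ._≟_ (J ++ b ∷ B) (j ∷ [])) (++-∷≢[ j ] J (≤-trans (n≤1+n _) 2+j≤b)) = refl

  hasPeakSet : List ℕ → List ℤ → Bool
  hasPeakSet T π = peakSet π == T

  peakSet-++-cases : ∀ (S₁ : List ℕ) y u z z′ r → All (_< suc (length u)) S₁ →
    let j = suc (length u); π = (y ∷ u) ++ z ∷ z′ ∷ r in
    𝟙 (hasPeakSet (S₁ ∷ʳ suc j) π) + 𝟙 (hasPeakSet S₁ π) + 𝟙 (hasPeakSet (S₁ ∷ʳ j) π)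
      ≡ 𝟙 (hasPeakSet S₁ (y ∷ u) ∧ peakFree (z ∷ z′ ∷ r))
  peakSet-++-cases S₁ y u z z′ r S₁<j = begin
      𝟙 (hasPeakSet (S₁ ++ suc j ∷ []) π) + 𝟙 (hasPeakSet S₁ π) + 𝟙 (hasPeakSet (S₁ ++ j ∷ []) π)
        ≡⟨ cong₂ (λ a b → 𝟙 a + 𝟙 b + 𝟙 (hasPeakSet (S₁ ++ j ∷ []) π)) (split (suc j ∷ []) (n≤1+n j ∷ []))
             (trans (cong₂ _==_ (peaksFrom-++ 1 y u z z′ r) (sym (++-identityʳ S₁))) (==-++ j P S₁ X [] P<j S₁<j j≤X [])) ⟩
      𝟙 ((P == S₁) ∧ (X == suc j ∷ [])) + 𝟙 ((P == S₁) ∧ (X == [])) + 𝟙 (hasPeakSet (S₁ ++ j ∷ []) π)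
        ≡⟨ cong (λ a → 𝟙 ((P == S₁) ∧ (X == suc j ∷ [])) + 𝟙 ((P == S₁) ∧ (X == [])) + 𝟙 a) (split (j ∷ []) (≤-refl ∷ [])) ⟩
      𝟙 ((P == S₁) ∧ (X == suc j ∷ [])) + 𝟙 ((P == S₁) ∧ (X == [])) + 𝟙 ((P == S₁) ∧ (X == j ∷ []))
        ≡⟨ 𝟙-∧-+-+ (P == S₁) (X == suc j ∷ []) (X == []) (X == j ∷ []) ⟩
      𝟙 (P == S₁) * (𝟙 (X == suc j ∷ []) + 𝟙 (X == []) + 𝟙 (X == j ∷ []))
        ≡⟨ cong (𝟙 (P == S₁) *_) (junction-cases j shape Q 2+j≤Q) ⟩
      𝟙 (P == S₁) * 𝟙 (Q == [])
        ≡⟨ cong (λ b → 𝟙 (P == S₁) * 𝟙 b) (peaksFrom==[] (j + 1) v) ⟩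
      𝟙 (P == S₁) * 𝟙 (peakFree v)
        ≡⟨ 𝟙-∧ (P == S₁) (peakFree v) ⟨
      𝟙 ((P == S₁) ∧ peakFree v) ∎
    where
    open ≡-Reasoning
    j : ℕ
    j = suc (length u)
    v π : List ℤ
    v = z ∷ z′ ∷ r
    π = (y ∷ u) ++ v
    P J Q X : List ℕ
    P = peakSet (y ∷ u)
    J = junctionPeaks 1 (y ∷ u) v
    Q = peaksFrom (j + 1) v
    X = J ++ Q
    P<j : All (_< j) P
    P<j = All.map ≤-pred (peaksFrom-upper 1 (y ∷ u))
    2+j≤Q : All (suc (suc j) ≤_) Q
    2+j≤Q = All.map (λ {p} → subst (λ i → suc i ≤ p) (+-comm j 1)) (peaksFrom-lower (j + 1) v)
    shape : JunctionShape j J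
    shape = subst (λ i → JunctionShape i J) (+-comm (length u) 1) (junctionPeaks-shape 1 y u z z′ r)
    j≤J : All (j ≤_) J
    j≤J = JunctionShape⇒All≥ shape
    j≤X : All (j ≤_) X
    j≤X = All.++⁺ j≤J (All.map (≤-trans (≤-trans (n≤1+n j) (n≤1+n (suc j)))) 2+j≤Q)
    split : ∀ T → All (j ≤_) T → (peakSet π == S₁ ++ T) ≡ (P == S₁) ∧ (X == T)
    split T j≤T = trans (cong (_== S₁ ++ T) (peaksFrom-++ 1 y u z z′ r)) (==-++ j P S₁ X T P<j S₁<j j≤X j≤T)

  countPB≡count : ∀ T n → countPB T n ≡ count (hasPeakSet T) n n
  countPB≡count T n = begin
      length (filterᵇ (hasPeakSet T) (filterᵇ (absCovers n) (words n (alphabet n))))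
        ≡⟨ length-filterᵇ (hasPeakSet T) (filterᵇ (absCovers n) (words n (alphabet n))) ⟩
      ∑ (filterᵇ (absCovers n) (words n (alphabet n))) (𝟙 ∘ hasPeakSet T)
        ≡⟨ ∑-filterᵇ (absCovers n) (words n (alphabet n)) (𝟙 ∘ hasPeakSet T) ⟩
      ∑ (words n (alphabet n)) (λ π → 𝟙 (absCovers n π) * 𝟙 (hasPeakSet T π))
        ≡⟨ cong (λ xs → ∑ (words n xs) (λ π → 𝟙 (absCovers n π) * 𝟙 (hasPeakSet T π))) (alphabet≡signedLetters n) ⟩
      ∑ (words n (signedLetters n)) (λ π → 𝟙 (absCovers n π) * 𝟙 (hasPeakSet T π))
        ≡⟨ ∑-words-cong n (signedLetters-Letter n) (λ π |π|≡n π-letters →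
             trans (cong (λ b → 𝟙 b * 𝟙 (hasPeakSet T π)) (absCovers≡distinctAbs n π |π|≡n π-letters))
               (sym (𝟙-∧ (distinctAbs π) (hasPeakSet T π)))) ⟩
      count (hasPeakSet T) n n ∎
    where open ≡-Reasoning

  hasPeakSet-skipInvariant : ∀ T → SkipInvariant (hasPeakSet T)
  hasPeakSet-skipInvariant T c w = cong (_== T) (peaksFrom-map (skipAbs-mono-< c) 1 w)

  countPB-+-+ : ∀ T₁ T₂ T₃ n → countPB T₁ n + countPB T₂ n + countPB T₃ n
    ≡ ∑ (words n (signedLetters n)) (λ π → 𝟙 (distinctAbs π) * (𝟙 (hasPeakSet T₁ π) + 𝟙 (hasPeakSet T₂ π) + 𝟙 (hasPeakSet T₃ π)))
  countPB-+-+ T₁ T₂ T₃ n = begin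
      countPB T₁ n + countPB T₂ n + countPB T₃ n
        ≡⟨ cong₂ _+_ (cong₂ _+_ (countPB≡count T₁ n) (countPB≡count T₂ n)) (countPB≡count T₃ n) ⟩
      ∑ W (λ π → 𝟙 (distinctAbs π ∧ hasPeakSet T₁ π)) + ∑ W (λ π → 𝟙 (distinctAbs π ∧ hasPeakSet T₂ π))
        + ∑ W (λ π → 𝟙 (distinctAbs π ∧ hasPeakSet T₃ π))
        ≡⟨ cong (_+ count (hasPeakSet T₃) n n) (∑-+ W _ _) ⟨
      ∑ W (λ π → 𝟙 (distinctAbs π ∧ hasPeakSet T₁ π) + 𝟙 (distinctAbs π ∧ hasPeakSet T₂ π))
        + ∑ W (λ π → 𝟙 (distinctAbs π ∧ hasPeakSet T₃ π))
        ≡⟨ ∑-+ W _ _ ⟨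
      ∑ W (λ π → 𝟙 (distinctAbs π ∧ hasPeakSet T₁ π) + 𝟙 (distinctAbs π ∧ hasPeakSet T₂ π) + 𝟙 (distinctAbs π ∧ hasPeakSet T₃ π))
        ≡⟨ ∑-cong W (λ π → 𝟙-∧-+-+ (distinctAbs π) (hasPeakSet T₁ π) (hasPeakSet T₂ π) (hasPeakSet T₃ π)) ⟩
      ∑ W (λ π → 𝟙 (distinctAbs π) * (𝟙 (hasPeakSet T₁ π) + 𝟙 (hasPeakSet T₂ π) + 𝟙 (hasPeakSet T₃ π))) ∎
    where
    open ≡-Reasoning
    W : List (List ℤ)
    W = words n (signedLetters n)

  countPB-split : ∀ (S₁ : List ℕ) j k → 1 ≤ j → 2 ≤ k → All (_< j) S₁ →
    countPB (S₁ ∷ʳ suc j) (j + k) + countPB S₁ (j + k) + countPB (S₁ ∷ʳ j) (j + k)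
      ≡ ((j + k) C j) * countPB S₁ j * count peakFree k k
  countPB-split S₁ j@(suc _) k (s≤s z≤n) 2≤k S₁<j = begin
      countPB S n + countPB S₁ n + countPB S₂ n
        ≡⟨ countPB-+-+ S S₁ S₂ n ⟩
      ∑ (words n L) F
        ≡⟨ ∑-words-+ j k L F ⟩
      ∑ (words j L) (λ u → ∑ (words k L) (λ v → F (u ++ v)))
        ≡⟨ ∑-words-cong j (signedLetters-Letter n) (λ u |u|≡j _ → ∑-words-cong k (signedLetters-Letter n) (λ v |v|≡k _ →
             by-peaks u v |u|≡j |v|≡k)) ⟩
      ∑ (words j L) (λ u → ∑ (words k L) (λ v → 𝟙 (distinctAbs (u ++ v) ∧ (hasPeakSet S₁ u ∧ peakFree v))))
        ≡⟨ count*count (hasPeakSet S₁) peakFree-skipInvariant j k n ⟩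
      count (hasPeakSet S₁) j n * count peakFree k (n ∸ j)
        ≡⟨ cong₂ _*_ (count≡C*count (hasPeakSet-skipInvariant S₁) j n (m≤m+n j k)) (cong (count peakFree k) (m+n∸m≡n j k)) ⟩
      (n C j) * count (hasPeakSet S₁) j j * count peakFree k k
        ≡⟨ cong (λ c → (n C j) * c * count peakFree k k) (countPB≡count S₁ j) ⟨
      (n C j) * countPB S₁ j * count peakFree k k ∎
    where
    open ≡-Reasoning
    n : ℕ
    n = j + k
    S S₂ : List ℕ
    S = S₁ ∷ʳ suc j
    S₂ = S₁ ∷ʳ j
    L : List ℤ
    L = signedLetters n
    F : List ℤ → ℕ
    F π = 𝟙 (distinctAbs π) * (𝟙 (hasPeakSet S π) + 𝟙 (hasPeakSet S₁ π) + 𝟙 (hasPeakSet S₂ π))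
    by-peaks : ∀ u v → length u ≡ j → length v ≡ k → F (u ++ v) ≡ 𝟙 (distinctAbs (u ++ v) ∧ (hasPeakSet S₁ u ∧ peakFree v))
    by-peaks (y ∷ u) (z ∷ z′ ∷ r) |u|≡j _ with refl ← suc-injective |u|≡j =
      trans (cong (𝟙 (distinctAbs π) *_) (peakSet-++-cases S₁ y u z z′ r S₁<j)) (sym (𝟙-∧ (distinctAbs π) _))
      where
      π : List ℤ
      π = (y ∷ u) ++ z ∷ z′ ∷ r
    by-peaks (y ∷ u) []           _ refl = ⊥-elim (<⇒≱ 2≤k z≤n)
    by-peaks (y ∷ u) (z ∷ [])     _ refl = ⊥-elim (<⇒≱ 2≤k (s≤s z≤n))

  admissible⇒peakSet : ∀ S → Admissible S → ∃ λ π → peakSet π ≡ S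
  admissible⇒peakSet S (n , nonempty) with filterᵇ-witness (hasPeakSet S) (B n) nonempty
  ... | π , has = π , ⌊⌋≡true⇒ (≡-dec ℕ._≟_ (peakSet π) S) has

  Separated-∷ʳ : ∀ xs m → Linked Separated (xs ∷ʳ m) → All (λ s → Separated s m) xs
  Separated-∷ʳ []          m _              = []
  Separated-∷ʳ (x ∷ [])    m (x≪m ∷ [-])    = x≪m ∷ []
  Separated-∷ʳ (x ∷ y ∷ xs) m (x≪y ∷ linked) with Separated-∷ʳ (y ∷ xs) m linked
  ... | y≪m ∷ xs≪m = <-trans x≪y (<-trans (n<1+n _) y≪m) ∷ y≪m ∷ xs≪m

  admissible-∷ʳ : ∀ S₁ m → Admissible (S₁ ∷ʳ m) → 2 ≤ m × All (_< m ∸ 1) S₁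
  admissible-∷ʳ S₁ m admissible with admissible⇒peakSet (S₁ ∷ʳ m) admissible
  ... | π , peaks≡ = proj₂ (All.∷ʳ⁻ (subst (All (2 ≤_)) peaks≡ (peaksFrom-lower 1 π)))
                  , All.map (separated⇒< m) (Separated-∷ʳ S₁ m (subst (Linked Separated) peaks≡ (peaksFrom-separated 1 π)))
    where
    separated⇒< : ∀ m {s} → Separated s m → s < m ∸ 1
    separated⇒< (suc m) s≪m = ≤-pred s≪m

  length-increasing : ∀ {b j} xs → Linked _<_ xs → All (b ≤_) xs → All (_< j) xs → length xs ≤ j ∸ b
  length-increasing []       _      _            _           = z≤n
  length-increasing {b} {j} (x ∷ xs) linked (b≤x ∷ b≤xs) (x<j ∷ xs<j) = begin
      suc (length xs)   ≤⟨ s≤s (length-increasing xs (tail linked) (above linked) xs<j) ⟩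
      suc (j ∸ suc x)   ≡⟨ +-∸-assoc 1 x<j ⟨
      j ∸ x             ≤⟨ ∸-monoʳ-≤ j b≤x ⟩
      j ∸ b             ∎
    where
    open ≤-Reasoning
    tail : ∀ {x xs} → Linked _<_ (x ∷ xs) → Linked _<_ xs
    tail [-]        = []
    tail (_ ∷ rest) = rest
    above : ∀ {x xs} → Linked _<_ (x ∷ xs) → All (suc x ≤_) xs
    above [-]            = []
    above (x<y ∷ linked) = x<y ∷ All.map (<-trans x<y) (above linked)

  insert-∷ʳ : ∀ x ys → All (_< x) ys → insert x ys ≡ ys ∷ʳ x
  insert-∷ʳ x []       []          = refl
  insert-∷ʳ x (y ∷ ys) (y<x ∷ ys<x) with ℕ.compare x y
  ... | ℕ.less .x k    = ⊥-elim (<-asym y<x (s≤s (m≤m+n x k)))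
  ... | ℕ.equal .x     = ⊥-elim (<-irrefl refl y<x)
  ... | ℕ.greater .y k = cong (y ∷_) (insert-∷ʳ (suc (y + k)) ys ys<x)

  toℚᵘ-/ : ∀ i d → ℚ.toℚᵘ (i ℚ./ suc d) ℚᵘ.≃ ℚᵘ.mkℚᵘ i d
  toℚᵘ-/ i d = toℚᵘ-fromℚᵘ (ℚᵘ.mkℚᵘ i d)

  toℚᵘ-homo-- : ∀ p q → ℚ.toℚᵘ (p ℚ.- q) ℚᵘ.≃ ℚ.toℚᵘ p ℚᵘ.- ℚ.toℚᵘ q
  toℚᵘ-homo-- p q = ℚᵘ.≃-trans (toℚᵘ-homo-+ p (ℚ.- q)) (ℚᵘ.+-congʳ (ℚ.toℚᵘ p) (toℚᵘ-homo‿- q))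

  -- The two sides of the cross-multiplied identity, in exactly the shape produced by unfolding ℚᵘ arithmetic.
  cross-multiplied : ∀ (a b c d k D E : ℤ) → a ℤ.+ b ℤ.+ c ≡ d ℤ.* k ℤ.* E →
    a ℤ.* (((D ℤ.* ℤ.+ 1) ℤ.* (ℤ.+ 1 ℤ.* (ℤ.+ 2 ℤ.* (D ℤ.* E)))) ℤ.* (D ℤ.* E))
      ≡ ((d ℤ.* k ℤ.* (ℤ.+ 1 ℤ.* (ℤ.+ 2 ℤ.* (D ℤ.* E))) ℤ.+ ℤ.- (ℤ.+ 2 ℤ.* b) ℤ.* (D ℤ.* ℤ.+ 1)) ℤ.* (D ℤ.* E)
         ℤ.+ ℤ.- c ℤ.* ((D ℤ.* ℤ.+ 1) ℤ.* (ℤ.+ 1 ℤ.* (ℤ.+ 2 ℤ.* (D ℤ.* E))))) ℤ.* (D ℤ.* E)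
  cross-multiplied a b c d k D E a+b+c≡dkE =
    trans (expand a b c D E) (trans (cong (λ t → (t ℤ.- b ℤ.- c) ℤ.* denominator) a+b+c≡dkE) (collect b c d k D E))
    where
    denominator : ℤ
    denominator = D ℤ.* ℤ.+ 1 ℤ.* (ℤ.+ 1 ℤ.* (ℤ.+ 2 ℤ.* (D ℤ.* E))) ℤ.* (D ℤ.* E)
    expand : ∀ a b c D E → a ℤ.* (((D ℤ.* ℤ.+ 1) ℤ.* (ℤ.+ 1 ℤ.* (ℤ.+ 2 ℤ.* (D ℤ.* E)))) ℤ.* (D ℤ.* E))
      ≡ (a ℤ.+ b ℤ.+ c ℤ.- b ℤ.- c) ℤ.* (D ℤ.* ℤ.+ 1 ℤ.* (ℤ.+ 1 ℤ.* (ℤ.+ 2 ℤ.* (D ℤ.* E))) ℤ.* (D ℤ.* E))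
    expand = ℤ-Ring.solve-∀
    collect : ∀ b c d k D E → (d ℤ.* k ℤ.* E ℤ.- b ℤ.- c) ℤ.* (D ℤ.* ℤ.+ 1 ℤ.* (ℤ.+ 1 ℤ.* (ℤ.+ 2 ℤ.* (D ℤ.* E))) ℤ.* (D ℤ.* E))
      ≡ ((d ℤ.* k ℤ.* (ℤ.+ 1 ℤ.* (ℤ.+ 2 ℤ.* (D ℤ.* E))) ℤ.+ ℤ.- (ℤ.+ 2 ℤ.* b) ℤ.* (D ℤ.* ℤ.+ 1)) ℤ.* (D ℤ.* E)
         ℤ.+ ℤ.- c ℤ.* ((D ℤ.* ℤ.+ 1) ℤ.* (ℤ.+ 1 ℤ.* (ℤ.+ 2 ℤ.* (D ℤ.* E))))) ℤ.* (D ℤ.* E)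
    collect = ℤ-Ring.solve-∀

  rational-identity : ∀ a b c d k D′ E′ → a + b + c ≡ d * k * suc E′ →
    (ℤ.+ a) ℚ./ (suc D′ * suc E′)
      ≡ (ℤ.+ d) ℚ./ suc D′ ℚ.* ((ℤ.+ k) ℚ./ 1) ℚ.- (ℤ.+ 2) ℚ./ 1 ℚ.* ((ℤ.+ b) ℚ./ (2 * (suc D′ * suc E′))) ℚ.- (ℤ.+ c) ℚ./ (suc D′ * suc E′)
  rational-identity a b c d k D′ E′ a+b+c≡dkE = toℚᵘ-injective (ℚᵘ.≃-trans (toℚᵘ-/ (ℤ.+ a) _)
    (ℚᵘ.≃-trans (ℚᵘ.*≡* (cross-multiplied (ℤ.+ a) (ℤ.+ b) (ℤ.+ c) (ℤ.+ d) (ℤ.+ k) (ℤ.+ suc D′) (ℤ.+ suc E′) a+b+c≡dkEℤ))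
      (ℚᵘ.≃-sym unnormalised)))
    where
    a+b+c≡dkEℤ : ℤ.+ a ℤ.+ ℤ.+ b ℤ.+ ℤ.+ c ≡ ℤ.+ d ℤ.* ℤ.+ k ℤ.* ℤ.+ suc E′
    a+b+c≡dkEℤ = trans (cong ℤ.+_ a+b+c≡dkE) (trans (ℤ.pos-* (d * k) (suc E′)) (cong (ℤ._* ℤ.+ suc E′) (ℤ.pos-* d k)))
    q₁ q₂ q₃ q₄ q₅ : ℚ.ℚ
    q₁ = (ℤ.+ d) ℚ./ suc D′
    q₂ = (ℤ.+ k) ℚ./ 1
    q₃ = (ℤ.+ 2) ℚ./ 1
    q₄ = (ℤ.+ b) ℚ./ (2 * (suc D′ * suc E′))
    q₅ = (ℤ.+ c) ℚ./ (suc D′ * suc E′)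
    unnormalised : ℚ.toℚᵘ (q₁ ℚ.* q₂ ℚ.- q₃ ℚ.* q₄ ℚ.- q₅) ℚᵘ.≃
      ℚᵘ.mkℚᵘ (ℤ.+ d) D′ ℚᵘ.* ℚᵘ.mkℚᵘ (ℤ.+ k) 0 ℚᵘ.- ℚᵘ.mkℚᵘ (ℤ.+ 2) 0 ℚᵘ.* ℚᵘ.mkℚᵘ (ℤ.+ b) (ℕ.pred (2 * (suc D′ * suc E′)))
        ℚᵘ.- ℚᵘ.mkℚᵘ (ℤ.+ c) (ℕ.pred (suc D′ * suc E′))
    unnormalised = ℚᵘ.≃-trans (toℚᵘ-homo-- (q₁ ℚ.* q₂ ℚ.- q₃ ℚ.* q₄) q₅) (ℚᵘ.+-cong
      (ℚᵘ.≃-trans (toℚᵘ-homo-- (q₁ ℚ.* q₂) (q₃ ℚ.* q₄)) (ℚᵘ.+-cong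
        (ℚᵘ.≃-trans (toℚᵘ-homo-* q₁ q₂) (ℚᵘ.*-cong (toℚᵘ-/ (ℤ.+ d) D′) (toℚᵘ-/ (ℤ.+ k) 0)))
        (ℚᵘ.-‿cong (ℚᵘ.≃-trans (toℚᵘ-homo-* q₃ q₄) (ℚᵘ.*-cong (toℚᵘ-/ (ℤ.+ 2) 0) (toℚᵘ-/ (ℤ.+ b) _))))))
      (ℚᵘ.-‿cong (toℚᵘ-/ (ℤ.+ c) _)))

  exponents : ∀ t j k → suc t ≤ 2 * j → 1 ≤ k →
    2 * (j + k) ∸ suc t ∸ 1 ≡ (2 * j ∸ t ∸ 1) + (2 * k ∸ 1) × 2 * (j + k) ∸ t ∸ 1 ≡ suc ((2 * j ∸ t ∸ 1) + (2 * k ∸ 1))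
  exponents t j k 1+t≤2j 1≤k =
    trans (cong (λ e → e ∸ suc t ∸ 1) (trans 2n≡ (shape₁ x y t))) (cong (_∸ 1) (m+n∸n≡m (suc (x + y)) (suc t))) ,
    trans (cong (λ e → e ∸ t ∸ 1) (trans 2n≡ (shape₂ x y t))) (cong (_∸ 1) (m+n∸n≡m (suc (suc (x + y))) t))
    where
    x y : ℕ
    x = 2 * j ∸ t ∸ 1
    y = 2 * k ∸ 1
    2n≡ : 2 * (j + k) ≡ x + suc t + (y + 1)
    2n≡ = trans (*-distribˡ-+ 2 j k) (cong₂ _+_
      (trans (sym (m∸n+n≡m 1+t≤2j)) (cong (_+ suc t) (trans (cong (2 * j ∸_) (+-comm 1 t)) (sym (∸-+-assoc (2 * j) t 1)))))
      (sym (m∸n+n≡m (≤-trans 1≤k (m≤m+n k (k + 0))))))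
    shape₁ : ∀ x y t → x + suc t + (y + 1) ≡ suc (x + y) + suc t
    shape₁ = solve-∀
    shape₂ : ∀ x y t → x + suc t + (y + 1) ≡ suc (suc (x + y)) + t
    shape₂ = solve-∀

  pB≡ : ∀ T n d .{{_ : ℕ.NonZero d}} → 2 ^ (2 * n ∸ length T ∸ 1) ≡ d → pB T n ≡ (ℤ.+ countPB T n) ℚ./ d
  pB≡ T n d e = /-cong {p₁ = ℤ.+ countPB T n} {q₁ = 2 ^ (2 * n ∸ length T ∸ 1)} {p₂ = ℤ.+ countPB T n} {q₂ = d}
    {{m^n≢0 2 (2 * n ∸ length T ∸ 1)}} refl e

  -- With x = 2j ∸ |S₁| ∸ 1 and y = 2k ∸ 1, pB divides by 2^(x+y) for S and S₂, by 2^(x+y+1) for S₁ at n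
  -- and by 2^x for S₁ at j, while #P_B(∅,k) = 2^y.
  pB-recurrence-+ : ∀ (S₁ : List ℕ) j k → 1 ≤ j → 2 ≤ k → length S₁ ≤ j → All (_< j) S₁ →
    pB (S₁ ∷ʳ suc j) (j + k)
      ≡ pB S₁ j ℚ.* ((ℤ.+ ((j + k) C j)) ℚ./ 1) ℚ.- (ℤ.+ 2) ℚ./ 1 ℚ.* pB S₁ (j + k) ℚ.- pB (S₁ ∷ʳ j) (j + k)
  pB-recurrence-+ S₁ j k 1≤j 2≤k t≤j S₁<j = begin
      pB (S₁ ∷ʳ suc j) n
        ≡⟨ pB≡ (S₁ ∷ʳ suc j) n (suc D′ * suc E′) (exponent-∷ʳ (suc j)) ⟩
      (ℤ.+ countPB (S₁ ∷ʳ suc j) n) ℚ./ (suc D′ * suc E′)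
        ≡⟨ rational-identity (countPB (S₁ ∷ʳ suc j) n) (countPB S₁ n) (countPB (S₁ ∷ʳ j) n) (countPB S₁ j) (n C j) D′ E′ counts ⟩
      (ℤ.+ countPB S₁ j) ℚ./ suc D′ ℚ.* ((ℤ.+ (n C j)) ℚ./ 1)
        ℚ.- (ℤ.+ 2) ℚ./ 1 ℚ.* ((ℤ.+ countPB S₁ n) ℚ./ (2 * (suc D′ * suc E′))) ℚ.- (ℤ.+ countPB (S₁ ∷ʳ j) n) ℚ./ (suc D′ * suc E′)
        ≡⟨ cong₂ (λ p q → p ℚ.* ((ℤ.+ (n C j)) ℚ./ 1) ℚ.- (ℤ.+ 2) ℚ./ 1 ℚ.* q ℚ.- (ℤ.+ countPB (S₁ ∷ʳ j) n) ℚ./ (suc D′ * suc E′))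
             (pB≡ S₁ j (suc D′) 2^x≡) (pB≡ S₁ n (2 * (suc D′ * suc E′)) (trans (cong (2 ^_) (proj₂ exps)) (cong (2 *_) 2^[x+y]≡))) ⟨
      pB S₁ j ℚ.* ((ℤ.+ (n C j)) ℚ./ 1) ℚ.- (ℤ.+ 2) ℚ./ 1 ℚ.* pB S₁ n ℚ.- (ℤ.+ countPB (S₁ ∷ʳ j) n) ℚ./ (suc D′ * suc E′)
        ≡⟨ cong (λ r → pB S₁ j ℚ.* ((ℤ.+ (n C j)) ℚ./ 1) ℚ.- (ℤ.+ 2) ℚ./ 1 ℚ.* pB S₁ n ℚ.- r) (pB≡ (S₁ ∷ʳ j) n (suc D′ * suc E′) (exponent-∷ʳ j)) ⟨
      pB S₁ j ℚ.* ((ℤ.+ (n C j)) ℚ./ 1) ℚ.- (ℤ.+ 2) ℚ./ 1 ℚ.* pB S₁ n ℚ.- pB (S₁ ∷ʳ j) n ∎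
    where
    open ≡-Reasoning
    n t x y D′ E′ : ℕ
    n = j + k
    t = length S₁
    x = 2 * j ∸ t ∸ 1
    y = 2 * k ∸ 1
    D′ = ℕ.pred (2 ^ x)
    E′ = ℕ.pred (2 ^ y)
    1≤k : 1 ≤ k
    1≤k = ≤-trans (s≤s z≤n) 2≤k
    exps : 2 * n ∸ suc t ∸ 1 ≡ x + y × 2 * n ∸ t ∸ 1 ≡ suc (x + y)
    exps = exponents t j k (≤-trans (+-mono-≤ 1≤j t≤j) (≤-reflexive (cong (j +_) (sym (+-identityʳ j))))) 1≤k
    2^x≡ : 2 ^ x ≡ suc D′
    2^x≡ = sym (suc-pred (2 ^ x) {{m^n≢0 2 x}})
    2^[x+y]≡ : 2 ^ (x + y) ≡ suc D′ * suc E′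
    2^[x+y]≡ = trans (^-distribˡ-+-* 2 x y) (cong₂ _*_ 2^x≡ (sym (suc-pred (2 ^ y) {{m^n≢0 2 y}})))
    exponent-∷ʳ : ∀ a → 2 ^ (2 * n ∸ length (S₁ ∷ʳ a) ∸ 1) ≡ suc D′ * suc E′
    exponent-∷ʳ a = trans (cong (λ l → 2 ^ (2 * n ∸ l ∸ 1)) (length-∷ʳ S₁ a)) (trans (cong (2 ^_) (proj₁ exps)) 2^[x+y]≡)
    counts : countPB (S₁ ∷ʳ suc j) n + countPB S₁ n + countPB (S₁ ∷ʳ j) n ≡ countPB S₁ j * (n C j) * suc E′
    counts = trans (countPB-split S₁ j k 1≤j 2≤k S₁<j)
      (cong₂ _*_ (*-comm (n C j) (countPB S₁ j)) (trans (count-peakFree k 1≤k) (sym (suc-pred (2 ^ y) {{m^n≢0 2 y}}))))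

  -- Stated with m ∸ 1 exactly as in the theorem: checking pB S₁ (suc j ∸ 1) against pB S₁ j would make
  -- Agda unfold the normalising division inside pB.
  pB-recurrence : ∀ (S₁ : List ℕ) m n → 2 ≤ m → m < n → length S₁ ≤ m ∸ 1 → All (_< m ∸ 1) S₁ →
    pB (S₁ ∷ʳ m) n
      ≡ pB S₁ (m ∸ 1) ℚ.* ((ℤ.+ (n C (m ∸ 1))) ℚ./ 1) ℚ.- (ℤ.+ 2) ℚ./ 1 ℚ.* pB S₁ n ℚ.- pB (S₁ ∷ʳ (m ∸ 1)) n
  pB-recurrence S₁ m n 2≤m m<n |S₁|≤ S₁< = subst₂
    (λ m′ n′ → pB (S₁ ∷ʳ m′) n′
      ≡ pB S₁ (m ∸ 1) ℚ.* ((ℤ.+ (n′ C (m ∸ 1))) ℚ./ 1) ℚ.- (ℤ.+ 2) ℚ./ 1 ℚ.* pB S₁ n′ ℚ.- pB (S₁ ∷ʳ (m ∸ 1)) n′)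
    1+[m∸1]≡m [m∸1]+[n∸[m∸1]]≡n
    (pB-recurrence-+ S₁ (m ∸ 1) (n ∸ (m ∸ 1)) (∸-monoˡ-≤ 1 2≤m) 2≤n∸[m∸1] |S₁|≤ S₁<)
    where
    1+[m∸1]≡m : suc (m ∸ 1) ≡ m
    1+[m∸1]≡m = trans (+-comm 1 (m ∸ 1)) (m∸n+n≡m (≤-trans (s≤s z≤n) 2≤m))
    [m∸1]+[n∸[m∸1]]≡n : (m ∸ 1) + (n ∸ (m ∸ 1)) ≡ n
    [m∸1]+[n∸[m∸1]]≡n = m+[n∸m]≡n (≤-trans (m∸n≤m m 1) (<⇒≤ m<n))
    2≤n∸[m∸1] : 2 ≤ n ∸ (m ∸ 1)
    2≤n∸[m∸1] = subst (_≤ n ∸ (m ∸ 1)) (m+n∸n≡m 2 (m ∸ 1)) (∸-monoˡ-≤ (m ∸ 1) (subst (λ x → suc x ≤ n) (sym 1+[m∸1]≡m) m<n))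


open import Defs
open import Data.Nat using (ℕ; _∸_; _<_)
open import Data.Nat.Combinatorics using (_C_)
open import Data.Integer using (+_)
open import Data.List using (List; _∷ʳ_)
open import Data.Rational using (ℚ; _/_; _*_; _-_)
open import Relation.Binary.PropositionalEquality using (_≡_)
open import Data.Nat using (_≤_; z≤n)
open import Data.List using (length)
open import Data.List.Relation.Unary.All as All using (All)
open import Data.Product using (proj₁; proj₂)
open import Relation.Binary.PropositionalEquality using (sym; subst)
open PeakCounting using (admissible-∷ʳ; Linked-++⁻ˡ; length-increasing; insert-∷ʳ; pB-recurrence)

corollary2p5 : (S₁ : List ℕ) (m : ℕ) →
    StrictlyIncreasing (S₁ ∷ʳ m) → Admissible (S₁ ∷ʳ m) →
    (n : ℕ) → m < n →
    pB (S₁ ∷ʳ m) n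
      ≡ pB S₁ (m ∸ 1) * ((+ (n C (m ∸ 1))) / 1)
        - ((+ 2) / 1) * pB S₁ n
        - pB (insert (m ∸ 1) S₁) n
corollary2p5 S₁ m increasing admissible n m<n =
  subst (λ S₂ → pB (S₁ ∷ʳ m) n ≡ pB S₁ (m ∸ 1) * ((+ (n C (m ∸ 1))) / 1) - ((+ 2) / 1) * pB S₁ n - pB S₂ n)
    (sym (insert-∷ʳ (m ∸ 1) S₁ S₁<m∸1))
    (pB-recurrence S₁ m n 2≤m m<n |S₁|≤m∸1 S₁<m∸1)
  where
  2≤m : 2 ≤ m
  2≤m = proj₁ (admissible-∷ʳ S₁ m admissible)
  S₁<m∸1 : All (_< m ∸ 1) S₁
  S₁<m∸1 = proj₂ (admissible-∷ʳ S₁ m admissible)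
  |S₁|≤m∸1 : length S₁ ≤ m ∸ 1
  |S₁|≤m∸1 = length-increasing S₁ (Linked-++⁻ˡ S₁ _ increasing) (All.universal (λ _ → z≤n) S₁) S₁<m∸1
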